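{- Let $\Gamma$ be a finite oriented simplicial complex on $n$ vertices, let $k\ge 1$, and let $G(S_k)$ be its $k$-simplex graph. Then: (a) For every $k$-simplex $\sigma\in S_k$, the $1$-norm of the $\sigma$ column of $H=I-\frac{1}{n}\Delta_k$ is $$\|H|\sigma\rangle\|_1 = 1+\frac{1}{n}\big(\deg(\sigma)-d_{\mathrm{up}}(\sigma)-k-1\big).$$ (b) The transition probabilities $P_{\sigma\tau}=\frac{|\langle\tau|H|\sigma\rangle|}{\|H|\sigma\rangle\|_1}$ are $$P_{\sigma\tau}=\begin{cases}\frac{1}{n+\deg(\sigma)-d_{\mathrm{up}}(\sigma)-k-1} & \sigma,\tau \text{ adjacent in } G(S_k),\\[2pt] \frac{n-d_{\mathrm{up}}(\sigma)-k-1}{n+\deg(\sigma)-d_{\mathrm{up}}(\sigma)-k-1} & \sigma=\tau,\\[2pt] 0 & \text{otherwise.}\end{cases}$$ (c) The maximum degree of a vertex of $G(S_k)$ is at most $(n-k-1)(k+1)$. If $\Gamma$ is the clique complex of a graph, then the maximum degree is at most $n-k-1$.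
   Context: A simplicial complex $\Gamma$ on vertex set $\{x_1,\dots,x_n\}$ is a family of subsets closed under taking subsets; its elements of size $k+1$ are $k$-simplices, and $S_k$ denotes the set of $k$-simplices. It is oriented via the order $x_1<\dots<x_n$. The boundary map $\partial_k:\mathbb{C}S_k\to\mathbb{C}S_{k-1}$ sends $|\{x_{i_0},\dots,x_{i_k}\}\rangle$ ($i_0<\dots<i_k$) to $\sum_{j=0}^k(-1)^{j+1}|\{x_{i_0},\dots,x_{i_k}\}\setminus\{x_{i_j}\}\rangle$. $\Delta_k$ is the matrix of $\partial_k^\dagger\partial_k+\partial_{k+1}\partial_{k+1}^\dagger$ in the basis $\{|\sigma\rangle:\sigma\in S_k\}$, and $H=I-\frac1n\Delta_k$. The up-degree $d_{\mathrm{up}}(\sigma)$ of $\sigma\in S_k$ is the number of $(k+1)$-simplices containing $\sigma$. The $k$-simplex graph $G(S_k)$ has vertex set $S_k$, with $\sigma\neq\tau$ adjacent iff $|\sigma\cap\tau|=k$ and $\sigma\cup\tau\notin\Gamma$; $\deg(\sigma)$ is the degree of $\sigma$ in this graph. $\|H|\sigma\rangle\|_1=\sum_{\tau\in S_k}|H_{\tau\sigma}|$. The clique complex of a graph $G$ is the simplicial complex whose simplices are the vertex sets of complete subgraphs of $G$. -}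

module Defs where

open import Data.Bool using (Bool; true; false; _∧_; not; if_then_else_)
open import Data.Nat as ℕ using (ℕ; zero; suc; NonZero; _≡ᵇ_)
open import Data.Integer as ℤ using (ℤ; +_)
open import Data.Rational as ℚ using (ℚ; 0ℚ; 1ℚ; _÷_; ≢-nonZero)
import Data.Rational.Properties as ℚP
open import Data.Fin using (Fin)
open import Data.Fin.Subset using (Subset; _⊆_; _∈_; _∩_; _∪_; ∣_∣; inside; outside)
open import Data.Fin.Subset.Properties using (_⊆?_)
open import Data.Vec using (Vec; []; _∷_)
import Data.Vec.Properties as VecP
import Data.Bool.Properties as BoolP
open import Data.List using (List; []; _∷_; filter; length; map; foldr; _++_)
open import Data.Maybe using (Maybe; just; nothing; maybe)
import Data.Maybe as Maybe
open import Relation.Nullary using (¬_; yes; no; does)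
open import Relation.Binary.PropositionalEquality using (_≡_; _≢_)

-- Simplicial complexes on the vertex set Fin n = {x_1 < ... < x_n}.
-- A simplex is a subset of Fin n (Data.Fin.Subset); the orientation is
-- the one induced by the order of Fin n.

record SimplicialComplex (n : ℕ) : Set where
  field
    mem    : Subset n → Bool
    closed : ∀ {σ τ : Subset n} → τ ⊆ σ → mem σ ≡ true → mem τ ≡ true
open SimplicialComplex public

allSubsets : (n : ℕ) → List (Subset n)
allSubsets zero    = [] ∷ []
allSubsets (suc n) = map (outside ∷_) (allSubsets n) ++ map (inside ∷_) (allSubsets n)

IsSimplex : ∀ {n} → SimplicialComplex n → ℕ → Subset n → Set
IsSimplex Γ k σ = (mem Γ σ ≡ true) × (∣ σ ∣ ≡ suc k)
  where open import Data.Product using (_×_)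

facesOfSize : ∀ {n} → SimplicialComplex n → ℕ → List (Subset n)
facesOfSize {n} Γ m = filter (λ σ → mem Γ σ ∧ (∣ σ ∣ ≡ᵇ m) BoolP.≟ true) (allSubsets n)

S : ∀ {n} → SimplicialComplex n → ℕ → List (Subset n)
S Γ k = facesOfSize Γ (suc k)

-- Boundary map coefficients.
-- delPos ρ σ = just j  iff  ρ = σ \ {x_{i_j}} where σ = {x_{i_0} < ... < x_{i_k}}
-- (j = number of elements of σ smaller than the removed vertex).

delPos : ∀ {n} → Subset n → Subset n → Maybe ℕ
delPos []            []            = nothing
delPos (true  ∷ ρ)   (true  ∷ σ)   = Maybe.map suc (delPos ρ σ)
delPos (false ∷ ρ)   (false ∷ σ)   = delPos ρ σ
delPos (false ∷ ρ)   (true  ∷ σ)   =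
  if does (VecP.≡-dec BoolP._≟_ ρ σ) then just 0 else nothing
delPos (true  ∷ ρ)   (false ∷ σ)   = nothing

negOnePow : ℕ → ℤ
negOnePow zero    = ℤ.1ℤ
negOnePow (suc m) = ℤ.- negOnePow m

-- matrix entry ⟨ρ| ∂ |σ⟩ of the boundary map : (-1)^(j+1) if ρ = σ \ {x_{i_j}}, else 0
bd : ∀ {n} → Subset n → Subset n → ℤ
bd ρ σ = maybe (λ j → negOnePow (suc j)) ℤ.0ℤ (delPos ρ σ)

sumℤ : List ℤ → ℤ
sumℤ = foldr ℤ._+_ ℤ.0ℤ

sumℚ : List ℚ → ℚ
sumℚ = foldr ℚ._+_ 0ℚ

-- ⟨τ| Δ_k |σ⟩ = ⟨τ| ∂_kᵀ ∂_k + ∂_{k+1} ∂_{k+1}ᵀ |σ⟩   (k ≥ 1; real matrices so † = ᵀ)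
-- down part sums over S_{k-1} (faces with k elements), up part over S_{k+1}.
Δ : ∀ {n} → SimplicialComplex n → ℕ → Subset n → Subset n → ℤ
Δ Γ k τ σ =
  sumℤ (map (λ ρ → bd ρ τ ℤ.* bd ρ σ) (facesOfSize Γ k))
  ℤ.+ sumℤ (map (λ μ → bd τ μ ℤ.* bd σ μ) (S Γ (suc k)))

δ : ∀ {n} → Subset n → Subset n → ℚ
δ τ σ = if does (VecP.≡-dec BoolP._≟_ τ σ) then 1ℚ else 0ℚ

H : ∀ {n} → .{{NonZero n}} → SimplicialComplex n → ℕ → Subset n → Subset n → ℚ
H {n} Γ k τ σ = δ τ σ ℚ.- (Δ Γ k τ σ ℚ./ n)

norm1 : ∀ {n} → .{{NonZero n}} → SimplicialComplex n → ℕ → Subset n → ℚ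
norm1 Γ k σ = sumℚ (map (λ τ → ℚ.∣ H Γ k τ σ ∣) (S Γ k))

dup : ∀ {n} → SimplicialComplex n → ℕ → Subset n → ℕ
dup Γ k σ = length (filter (σ ⊆?_) (S Γ (suc k)))

adjᵇ : ∀ {n} → SimplicialComplex n → ℕ → Subset n → Subset n → Bool
adjᵇ Γ k σ τ =
  not (does (VecP.≡-dec BoolP._≟_ σ τ)) ∧ (∣ σ ∩ τ ∣ ≡ᵇ k) ∧ not (mem Γ (σ ∪ τ))

Adjacent : ∀ {n} → SimplicialComplex n → ℕ → Subset n → Subset n → Set
Adjacent Γ k σ τ = adjᵇ Γ k σ τ ≡ true

deg : ∀ {n} → SimplicialComplex n → ℕ → Subset n → ℕ
deg Γ k σ = length (filter (λ τ → adjᵇ Γ k σ τ BoolP.≟ true) (S Γ k))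

-- total division on ℚ (x ÷₀ 0 = 0); only used where the divisor is nonzero
_÷₀_ : ℚ → ℚ → ℚ
p ÷₀ q with q ℚP.≟ 0ℚ
... | yes _   = 0ℚ
... | no q≢0  = _÷_ p q {{≢-nonZero q≢0}}

P : ∀ {n} → .{{NonZero n}} → SimplicialComplex n → ℕ → Subset n → Subset n → ℚ
P Γ k σ τ = ℚ.∣ H Γ k τ σ ∣ ÷₀ norm1 Γ k σ

fromℤ : ℤ → ℚ
fromℤ z = z ℚ./ 1

record Graph (n : ℕ) : Set where
  field
    E      : Fin n → Fin n → Bool
    E-sym  : ∀ i j → E i j ≡ E j i
    E-irr  : ∀ i → E i i ≡ false
open Graph public

IsClique : ∀ {n} → Graph n → Subset n → Set
IsClique G σ = ∀ i j → i ∈ σ → j ∈ σ → i ≢ j → E G i j ≡ true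

IsCliqueComplexOf : ∀ {n} → SimplicialComplex n → Graph n → Set
IsCliqueComplexOf Γ G = ∀ σ → (mem Γ σ ≡ true → IsClique G σ) × (IsClique G σ → mem Γ σ ≡ true)
  where open import Data.Product using (_×_)

-- Summed over all subsets of Fin n, ∂ᵀ∂ + ∂∂ᵀ is the Laplacian of the full simplex on n vertices,
-- which is n times the identity.  For a k-simplex τ of Γ every facet of τ lies in Γ, so Δ_k agrees
-- with it in the down part, while in the up part two distinct k-simplices τ, σ can only share the
-- cofacet τ ∪ σ.  Hence ⟨σ|Δ_k|σ⟩ = k + 1 + d_up(σ), and for τ ≠ σ the entry ⟨τ|Δ_k|σ⟩ is ±1 exactly
-- when τ and σ are adjacent in G(S_k), and 0 otherwise.  Summing |⟨τ|H|σ⟩| over τ gives (a), and (b)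
-- divides one entry by that sum.  For (c), a neighbour of σ arises by exchanging one of the k + 1
-- vertices of σ for one of the n - k - 1 others; in a clique complex it is even determined by the
-- cofacet σ ∪ τ, since two neighbours with the same cofacet would make that cofacet a clique, hence
-- a simplex of Γ.

module Submission where

open import Defs
open import Data.Bool using (Bool; true; false; _∧_; not)
import Data.Bool.Properties as BoolP
open import Data.Empty using (⊥-elim)
open import Data.Fin using (Fin)
open import Data.Fin.Subset using (Subset; _⊆_; _∈_; _∩_; _∪_; ∣_∣; inside; outside)
open import Data.Fin.Subset.Properties
  using (_⊆?_; _∈?_; p⊆q⇒∣p∣≤∣q∣; ∣p∣≤n; ∣p∩q∣≤∣p∣; ∩-comm; ∪-comm; x∈p∪q⁻; p⊆p∪q; q⊆p∪q)
open import Data.Integer as ℤ using (ℤ; +_; -[1+_]; 0ℤ; 1ℤ)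
import Data.Integer.Properties as ℤP
open import Data.Integer.Tactic.RingSolver using (solve-∀)
open import Data.List using (List; []; _∷_; filter; length; map; _++_)
import Data.List.Properties as ListP
open import Data.Maybe using (just; nothing; is-just)
open import Data.Nat as ℕ using (ℕ; zero; suc; NonZero; _≤_; _∸_; _*_; _≡ᵇ_)
import Data.Nat.Properties as ℕP
open import Data.Product using (_×_; _,_; proj₁; proj₂; ∃)
open import Data.Rational as ℚ using (1ℚ; 0ℚ; _÷_; ≢-nonZero)
import Data.Rational.Properties as ℚP
open import Data.Rational.Unnormalised as ℚᵘ using (mkℚᵘ; *≡*)
import Data.Rational.Unnormalised.Properties as ℚᵘP
open import Data.Sum using (_⊎_; inj₁; inj₂; map₁; [_,_]′)
open import Data.Vec using ([]; _∷_)
import Data.Vec.Properties as VecP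
open import Function using (_∘_)
open import Relation.Binary.Definitions using (DecidableEquality)
open import Relation.Binary.PropositionalEquality
open import Relation.Nullary using (¬_; Dec; yes; no; does)
open import Relation.Nullary.Decidable using (dec-true; dec-false)

private variable
  A B : Set
  n : ℕ

true≢false : true ≢ false
true≢false ()

does-≟-true : ∀ b → does (b BoolP.≟ true) ≡ b
does-≟-true true  = refl
does-≟-true false = refl

does-true : ∀ {A : Set} (a? : Dec A) → does a? ≡ true → A
does-true (yes a) _ = a

≡⇒≡ᵇ-true : {a b : ℕ} → a ≡ b → (a ≡ᵇ b) ≡ true
≡⇒≡ᵇ-true {a} {b} = dec-true (a ℕP.≟ b)

≡ᵇ-true⇒≡ : {a b : ℕ} → (a ≡ᵇ b) ≡ true → a ≡ b
≡ᵇ-true⇒≡ {a} {b} = does-true (a ℕP.≟ b)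

𝟙 : Bool → ℤ
𝟙 true  = 1ℤ
𝟙 false = 0ℤ

𝟙-∧ : ∀ a b → 𝟙 (a ∧ b) ≡ 𝟙 a ℤ.* 𝟙 b
𝟙-∧ false b     = refl
𝟙-∧ true  false = refl
𝟙-∧ true  true  = refl

𝟙-≥0 : ∀ b → 0ℤ ℤ.≤ 𝟙 b
𝟙-≥0 true  = ℤ.+≤+ ℕ.z≤n
𝟙-≥0 false = ℤ.+≤+ ℕ.z≤n

𝟙-mono : ∀ {a b} → (a ≡ true → b ≡ true) → 𝟙 a ℤ.≤ 𝟙 b
𝟙-mono {false} {b} _ = 𝟙-≥0 b
𝟙-mono {true}      h rewrite h refl = ℤP.≤-refl

𝟙-*-redundant : ∀ {b} x → (b ≡ false → x ≡ 0ℤ) → 𝟙 b ℤ.* x ≡ x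
𝟙-*-redundant {false} x h = sym (h refl)
𝟙-*-redundant {true}  x h = ℤP.*-identityˡ x

𝟙-∧-* : ∀ b {c} x → (c ≡ false → x ≡ 0ℤ) → 𝟙 (b ∧ c) ℤ.* x ≡ 𝟙 b ℤ.* x
𝟙-∧-* false         x _    = refl
𝟙-∧-* true  {true}  x _    = refl
𝟙-∧-* true  {false} x x≡0 = sym (cong (1ℤ ℤ.*_) (x≡0 refl))

𝟙-*-≤ : ∀ b {x} → 0ℤ ℤ.≤ x → 𝟙 b ℤ.* x ℤ.≤ x
𝟙-*-≤ false 0≤x = 0≤x
𝟙-*-≤ true  0≤x = ℤP.≤-reflexive (ℤP.*-identityˡ _)

𝟙-∧-shuffle : ∀ a b c → 𝟙 (a ∧ b) ℤ.* 𝟙 c ≡ 𝟙 a ℤ.* 𝟙 (c ∧ b)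
𝟙-∧-shuffle false _     _     = refl
𝟙-∧-shuffle true  false false = refl
𝟙-∧-shuffle true  false true  = refl
𝟙-∧-shuffle true  true  false = refl
𝟙-∧-shuffle true  true  true  = refl

𝟙-not-* : ∀ b x → x ℤ.+ 𝟙 b ℤ.* ℤ.- x ≡ 𝟙 (not b) ℤ.* x
𝟙-not-* false x = trans (ℤP.+-identityʳ x) (sym (ℤP.*-identityˡ x))
𝟙-not-* true  x = trans (cong (ℤ._+_ x) (ℤP.*-identityˡ (ℤ.- x))) (ℤP.+-inverseʳ x)

∣𝟙*∣ : ∀ b x → + ℤ.∣ 𝟙 b ℤ.* x ∣ ≡ 𝟙 b ℤ.* + ℤ.∣ x ∣
∣𝟙*∣ false x = refl
∣𝟙*∣ true  x = trans (cong (+_ ∘ ℤ.∣_∣) (ℤP.*-identityˡ x)) (sym (ℤP.*-identityˡ _))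

*-cong-0 : ∀ a b {x} → x ≡ 0ℤ → a ℤ.* x ≡ b ℤ.* x
*-cong-0 a b refl = trans (ℤP.*-zeroʳ a) (sym (ℤP.*-zeroʳ b))

𝟙-*-cong : ∀ b {x y} → (b ≡ true → x ≡ y) → 𝟙 b ℤ.* x ≡ 𝟙 b ℤ.* y
𝟙-*-cong false h = refl
𝟙-*-cong true  h = cong (1ℤ ℤ.*_) (h refl)

m-n≡m∸n : {a b : ℕ} → b ≤ a → + a ℤ.- + b ≡ + (a ∸ b)
m-n≡m∸n {a} {b} b≤a = trans (ℤP.m-n≡m⊖n a b) (ℤP.⊖-≥ b≤a)

∸-suc : ∀ a b → a ∸ suc b ≡ a ∸ b ∸ 1
∸-suc a b = sym (trans (ℕP.∸-+-assoc a b 1) (cong (a ∸_) (ℕP.+-comm b 1)))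

sum-++ : ∀ (xs ys : List ℤ) → sumℤ (xs ++ ys) ≡ sumℤ xs ℤ.+ sumℤ ys
sum-++ []       ys = sym (ℤP.+-identityˡ _)
sum-++ (x ∷ xs) ys = trans (cong (ℤ._+_ x) (sum-++ xs ys)) (sym (ℤP.+-assoc x _ _))

sum-map-+ : ∀ (f g : A → ℤ) xs →
  sumℤ (map (λ x → f x ℤ.+ g x) xs) ≡ sumℤ (map f xs) ℤ.+ sumℤ (map g xs)
sum-map-+ f g []       = refl
sum-map-+ f g (x ∷ xs) rewrite sum-map-+ f g xs = interchange (f x) (g x) _ _
  where
  interchange : ∀ a b c d → (a ℤ.+ b) ℤ.+ (c ℤ.+ d) ≡ (a ℤ.+ c) ℤ.+ (b ℤ.+ d)
  interchange = solve-∀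

sum-map-*ˡ : ∀ c (f : A → ℤ) xs → sumℤ (map (λ x → c ℤ.* f x) xs) ≡ c ℤ.* sumℤ (map f xs)
sum-map-*ˡ c f []       = sym (ℤP.*-zeroʳ c)
sum-map-*ˡ c f (x ∷ xs) rewrite sum-map-*ˡ c f xs = sym (ℤP.*-distribˡ-+ c (f x) _)

sum-map-0 : ∀ (xs : List A) → sumℤ (map (λ _ → 0ℤ) xs) ≡ 0ℤ
sum-map-0 []       = refl
sum-map-0 (x ∷ xs) = trans (ℤP.+-identityˡ _) (sum-map-0 xs)

sum-map-mono-≤ : ∀ {f g : A → ℤ} xs → (∀ x → f x ℤ.≤ g x) → sumℤ (map f xs) ℤ.≤ sumℤ (map g xs)
sum-map-mono-≤ []       f≤g = ℤP.≤-refl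
sum-map-mono-≤ (x ∷ xs) f≤g = ℤP.+-mono-≤ (f≤g x) (sum-map-mono-≤ xs f≤g)

sum-map-filter : ∀ {P : A → Set} (P? : ∀ x → Dec (P x)) (f : A → ℤ) xs →
  sumℤ (map f (filter P? xs)) ≡ sumℤ (map (λ x → 𝟙 (does (P? x)) ℤ.* f x) xs)
sum-map-filter P? f []       = refl
sum-map-filter P? f (x ∷ xs) with does (P? x)
... | true  = cong₂ ℤ._+_ (sym (ℤP.*-identityˡ (f x))) (sum-map-filter P? f xs)
... | false = trans (sum-map-filter P? f xs) (sym (ℤP.+-identityˡ _))

length-filter : ∀ {P : A → Set} (P? : ∀ x → Dec (P x)) xs →
  + length (filter P? xs) ≡ sumℤ (map (λ x → 𝟙 (does (P? x))) xs)
length-filter P? []       = refl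
length-filter P? (x ∷ xs) with does (P? x)
... | true  = cong (ℤ._+_ 1ℤ) (length-filter P? xs)
... | false = trans (length-filter P? xs) (sym (ℤP.+-identityˡ _))

sum-map-swap : ∀ (f : A → B → ℤ) xs ys →
  sumℤ (map (λ x → sumℤ (map (f x) ys)) xs) ≡ sumℤ (map (λ y → sumℤ (map (λ x → f x y) xs)) ys)
sum-map-swap f []       ys = sym (sum-map-0 ys)
sum-map-swap f (x ∷ xs) ys rewrite sum-map-swap f xs ys =
  sym (sum-map-+ (f x) (λ y → sumℤ (map (λ x → f x y) xs)) ys)

sum-map-𝟙≡0⊎∃ : ∀ (p : A → Bool) xs → sumℤ (map (𝟙 ∘ p) xs) ≡ 0ℤ ⊎ ∃ λ x → p x ≡ true
sum-map-𝟙≡0⊎∃ p []       = inj₁ refl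
sum-map-𝟙≡0⊎∃ p (x ∷ xs) with p x in px
... | true  = inj₂ (x , px)
... | false = map₁ (trans (ℤP.+-identityˡ _)) (sum-map-𝟙≡0⊎∃ p xs)

_≟ˢ_ : ∀ {n} → DecidableEquality (Subset n)
_≟ˢ_ = VecP.≡-dec BoolP._≟_

≟ˢ-refl : ∀ {n} (x : Subset n) → does (x ≟ˢ x) ≡ true
≟ˢ-refl x = dec-true (x ≟ˢ x) refl

≟ˢ-≢ : {x y : Subset n} → x ≢ y → does (x ≟ˢ y) ≡ false
≟ˢ-≢ {x = x} {y} = dec-false (x ≟ˢ y)

≟ˢ-true : {x y : Subset n} → does (x ≟ˢ y) ≡ true → x ≡ y
≟ˢ-true {x = x} {y} = does-true (x ≟ˢ y)

δℤ : ∀ {n} → Subset n → Subset n → ℤ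
δℤ x y = 𝟙 (does (x ≟ˢ y))

δℤ-refl : (x : Subset n) → δℤ x x ≡ 1ℤ
δℤ-refl x = cong 𝟙 (≟ˢ-refl x)

δℤ-≢ : {x y : Subset n} → x ≢ y → δℤ x y ≡ 0ℤ
δℤ-≢ x≢y = cong 𝟙 (≟ˢ-≢ x≢y)

δℤ-sym : (x y : Subset n) → δℤ x y ≡ δℤ y x
δℤ-sym x y with x ≟ˢ y | y ≟ˢ x
... | yes _   | yes _   = refl
... | no  _   | no  _   = refl
... | yes x≡y | no  y≢x = ⊥-elim (y≢x (sym x≡y))
... | no  x≢y | yes y≡x = ⊥-elim (x≢y (sym y≡x))

∑ : ∀ {n} → (Subset n → ℤ) → ℤ
∑ {n} f = sumℤ (map f (allSubsets n))

∑-∷ : (f : Subset (suc n) → ℤ) → ∑ f ≡ ∑ (f ∘ (outside ∷_)) ℤ.+ ∑ (f ∘ (inside ∷_))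
∑-∷ {n} f = begin
  sumℤ (map f (map (outside ∷_) subsets ++ map (inside ∷_) subsets))
    ≡⟨ cong sumℤ (ListP.map-++ f (map (outside ∷_) subsets) _) ⟩
  sumℤ (map f (map (outside ∷_) subsets) ++ map f (map (inside ∷_) subsets))
    ≡⟨ sum-++ (map f (map (outside ∷_) subsets)) _ ⟩
  sumℤ (map f (map (outside ∷_) subsets)) ℤ.+ sumℤ (map f (map (inside ∷_) subsets))
    ≡⟨ sym (cong₂ ℤ._+_ (cong sumℤ (ListP.map-∘ subsets)) (cong sumℤ (ListP.map-∘ subsets))) ⟩
  ∑ (f ∘ (outside ∷_)) ℤ.+ ∑ (f ∘ (inside ∷_)) ∎
  where
  open ≡-Reasoning
  subsets : List (Subset n)
  subsets = allSubsets n

∑-cong : ∀ {f g : Subset n → ℤ} → (∀ x → f x ≡ g x) → ∑ f ≡ ∑ g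
∑-cong {n} f≗g = cong sumℤ (ListP.map-cong f≗g (allSubsets n))

∑-zero : ∀ {f : Subset n → ℤ} → (∀ x → f x ≡ 0ℤ) → ∑ f ≡ 0ℤ
∑-zero {n} f≗0 = trans (∑-cong f≗0) (sum-map-0 (allSubsets n))

∑-mono-≤ : ∀ {f g : Subset n → ℤ} → (∀ x → f x ℤ.≤ g x) → ∑ f ℤ.≤ ∑ g
∑-mono-≤ {n} = sum-map-mono-≤ (allSubsets n)

∑-outside : (f : Subset (suc n) → ℤ) → (∀ x → f (inside ∷ x) ≡ 0ℤ) → ∑ f ≡ ∑ (f ∘ (outside ∷_))
∑-outside {n} f inside≡0 =
  trans (∑-∷ f) (trans (cong (ℤ._+_ (∑ (f ∘ (outside ∷_)))) (∑-zero {n} inside≡0)) (ℤP.+-identityʳ _))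

∑-inside : (f : Subset (suc n) → ℤ) → (∀ x → f (outside ∷ x) ≡ 0ℤ) → ∑ f ≡ ∑ (f ∘ (inside ∷_))
∑-inside {n} f outside≡0 =
  trans (∑-∷ f) (trans (cong (ℤ._+ ∑ (f ∘ (inside ∷_))) (∑-zero {n} outside≡0)) (ℤP.+-identityˡ _))

∑-point : ∀ {n} (f : Subset n → ℤ) a → (∀ x → x ≢ a → f x ≡ 0ℤ) → ∑ f ≡ f a
∑-point {zero}  f []            _   = ℤP.+-identityʳ _
∑-point {suc n} f (outside ∷ a) f≡0 = trans (∑-outside f (λ x → f≡0 _ λ ()))
  (∑-point (f ∘ (outside ∷_)) a (λ x x≢a → f≡0 _ (x≢a ∘ VecP.∷-injectiveʳ)))
∑-point {suc n} f (inside ∷ a)  f≡0 = trans (∑-inside f (λ x → f≡0 _ λ ()))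
  (∑-point (f ∘ (inside ∷_)) a (λ x x≢a → f≡0 _ (x≢a ∘ VecP.∷-injectiveʳ)))

∑-swap : ∀ {n m} (f : Subset n → Subset m → ℤ) → ∑ (λ x → ∑ (f x)) ≡ ∑ (λ y → ∑ (λ x → f x y))
∑-swap {n} {m} f = sum-map-swap f (allSubsets n) (allSubsets m)

∑-𝟙≡0⊎∃ : ∀ {n} (p : Subset n → Bool) → ∑ (𝟙 ∘ p) ≡ 0ℤ ⊎ ∃ λ x → p x ≡ true
∑-𝟙≡0⊎∃ {n} p = sum-map-𝟙≡0⊎∃ p (allSubsets n)

∑-δ : (a : Subset n) (g : Subset n → ℤ) → ∑ (λ x → δℤ x a ℤ.* g x) ≡ g a
∑-δ a g = trans (∑-point _ a (λ x x≢a → cong (ℤ._* g x) (δℤ-≢ x≢a)))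
                (trans (cong (ℤ._* g a) (δℤ-refl a)) (ℤP.*-identityˡ (g a)))

∑-𝟙-injection : ∀ {n m} (P : Subset n → Bool) (Q : Subset m → Bool) (f : Subset n → Subset m) →
  (∀ x → P x ≡ true → Q (f x) ≡ true) →
  (∀ x y → P x ≡ true → P y ≡ true → f x ≡ f y → x ≡ y) →
  ∑ (𝟙 ∘ P) ℤ.≤ ∑ (𝟙 ∘ Q)
∑-𝟙-injection P Q f P⇒Q f-inj = begin
  ∑ (𝟙 ∘ P)                                   ≡⟨ ∑-cong (λ x → sym (fibre-point x)) ⟩
  ∑ (λ x → ∑ (λ y → 𝟙 (hits y x)))            ≡⟨ ∑-swap (λ x y → 𝟙 (hits y x)) ⟩
  ∑ (λ y → ∑ (λ x → 𝟙 (hits y x)))            ≤⟨ ∑-mono-≤ fibre-≤ ⟩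
  ∑ (𝟙 ∘ Q)                                   ∎
  where
  open ℤP.≤-Reasoning
  hits : Subset _ → Subset _ → Bool
  hits y x = P x ∧ does (y ≟ˢ f x)

  fibre-point : ∀ x → ∑ (λ y → 𝟙 (hits y x)) ≡ 𝟙 (P x)
  fibre-point x = trans (∑-point _ (f x) miss)
    (cong 𝟙 (trans (cong (P x ∧_) (≟ˢ-refl (f x))) (BoolP.∧-identityʳ (P x))))
    where
    miss : ∀ y → y ≢ f x → 𝟙 (hits y x) ≡ 0ℤ
    miss y y≢fx = cong 𝟙 (trans (cong (P x ∧_) (≟ˢ-≢ y≢fx)) (BoolP.∧-zeroʳ (P x)))

  fibre-≤ : ∀ y → ∑ (λ x → 𝟙 (hits y x)) ℤ.≤ 𝟙 (Q y)
  fibre-≤ y with ∑-𝟙≡0⊎∃ (hits y)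
  ... | inj₁ ∑≡0         = subst (ℤ._≤ 𝟙 (Q y)) (sym ∑≡0) (𝟙-≥0 (Q y))
  ... | inj₂ (x₀ , hit₀) = subst (ℤ._≤ 𝟙 (Q y)) (sym (∑-point _ x₀ miss)) (𝟙-mono (λ _ → Qy))
    where
    Px₀ : P x₀ ≡ true
    Px₀ = BoolP.∧-conicalˡ _ _ hit₀
    y≡fx₀ : y ≡ f x₀
    y≡fx₀ = ≟ˢ-true (BoolP.∧-conicalʳ (P x₀) _ hit₀)
    Qy : Q y ≡ true
    Qy = subst (λ z → Q z ≡ true) (sym y≡fx₀) (P⇒Q x₀ Px₀)
    miss : ∀ x → x ≢ x₀ → 𝟙 (hits y x) ≡ 0ℤ
    miss x x≢x₀ with hits y x in hit
    ... | false = refl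
    ... | true  = ⊥-elim (x≢x₀ (f-inj x x₀ (BoolP.∧-conicalˡ _ _ hit) Px₀
                    (trans (sym (≟ˢ-true (BoolP.∧-conicalʳ _ _ hit))) y≡fx₀)))

facetᵇ : ∀ {n} → Subset n → Subset n → Bool
facetᵇ ρ σ = is-just (delPos ρ σ)

⊆?-as-∩ : (σ τ : Subset n) → does (σ ⊆? τ) ≡ (∣ σ ∩ τ ∣ ≡ᵇ ∣ σ ∣)
⊆?-as-∩ []            []            = refl
⊆?-as-∩ (inside  ∷ σ) (inside  ∷ τ) = ⊆?-as-∩ σ τ
⊆?-as-∩ (outside ∷ σ) (outside ∷ τ) = ⊆?-as-∩ σ τ
⊆?-as-∩ (outside ∷ σ) (inside  ∷ τ) = ⊆?-as-∩ σ τ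
⊆?-as-∩ (inside  ∷ σ) (outside ∷ τ) =
  sym (dec-false (∣ σ ∩ τ ∣ ℕP.≟ suc ∣ σ ∣) (λ eq → ℕP.<-irrefl eq (ℕ.s≤s (∣p∩q∣≤∣p∣ σ τ))))

≟ˢ-as-⊆ : (σ μ : Subset n) → does (σ ≟ˢ μ) ≡ does (σ ⊆? μ) ∧ (∣ μ ∣ ≡ᵇ ∣ σ ∣)
≟ˢ-as-⊆ []            []            = refl
≟ˢ-as-⊆ (inside  ∷ σ) (inside  ∷ μ) = ≟ˢ-as-⊆ σ μ
≟ˢ-as-⊆ (outside ∷ σ) (outside ∷ μ) = ≟ˢ-as-⊆ σ μ
≟ˢ-as-⊆ (inside  ∷ σ) (outside ∷ μ) = refl
≟ˢ-as-⊆ (outside ∷ σ) (inside  ∷ μ) with σ ⊆? μ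
... | no  _   = refl
... | yes σ⊆μ = sym (dec-false (suc ∣ μ ∣ ℕP.≟ ∣ σ ∣) (ℕP.<⇒≢ (ℕ.s≤s (p⊆q⇒∣p∣≤∣q∣ σ⊆μ)) ∘ sym))

facetᵇ-as-⊆ : (ρ σ : Subset n) → facetᵇ ρ σ ≡ does (ρ ⊆? σ) ∧ (∣ σ ∣ ≡ᵇ suc ∣ ρ ∣)
facetᵇ-as-⊆ []            []            = refl
facetᵇ-as-⊆ (inside  ∷ ρ) (inside  ∷ σ) with delPos ρ σ | facetᵇ-as-⊆ ρ σ
... | just _  | eq = eq
... | nothing | eq = eq
facetᵇ-as-⊆ (outside ∷ ρ) (outside ∷ σ) = facetᵇ-as-⊆ ρ σ
facetᵇ-as-⊆ (inside  ∷ ρ) (outside ∷ σ) = refl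
facetᵇ-as-⊆ (outside ∷ ρ) (inside  ∷ σ) with does (ρ ≟ˢ σ) | ≟ˢ-as-⊆ ρ σ
... | true  | eq = eq
... | false | eq = eq

facetᵇ-as-∩ : (ρ σ : Subset n) → ∣ σ ∣ ≡ suc ∣ ρ ∣ → facetᵇ ρ σ ≡ (∣ ρ ∩ σ ∣ ≡ᵇ ∣ ρ ∣)
facetᵇ-as-∩ ρ σ ∣σ∣≡1+∣ρ∣ = begin
  facetᵇ ρ σ                                    ≡⟨ facetᵇ-as-⊆ ρ σ ⟩
  does (ρ ⊆? σ) ∧ (∣ σ ∣ ≡ᵇ suc ∣ ρ ∣)           ≡⟨ cong (does (ρ ⊆? σ) ∧_) (≡⇒≡ᵇ-true ∣σ∣≡1+∣ρ∣) ⟩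
  does (ρ ⊆? σ) ∧ true                          ≡⟨ BoolP.∧-identityʳ _ ⟩
  does (ρ ⊆? σ)                                 ≡⟨ ⊆?-as-∩ ρ σ ⟩
  (∣ ρ ∩ σ ∣ ≡ᵇ ∣ ρ ∣)                           ∎
  where open ≡-Reasoning

facetᵇ-true : (ρ σ : Subset n) → facetᵇ ρ σ ≡ true → ρ ⊆ σ × ∣ σ ∣ ≡ suc ∣ ρ ∣
facetᵇ-true ρ σ is-facet =
  does-true (ρ ⊆? σ) (BoolP.∧-conicalˡ _ _ facet-conditions) ,
  ≡ᵇ-true⇒≡ (BoolP.∧-conicalʳ _ _ facet-conditions)
  where facet-conditions = trans (sym (facetᵇ-as-⊆ ρ σ)) is-facet

∣∪∣+∣∩∣ : (σ τ : Subset n) → ∣ σ ∪ τ ∣ ℕ.+ ∣ σ ∩ τ ∣ ≡ ∣ σ ∣ ℕ.+ ∣ τ ∣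
∣∪∣+∣∩∣ []            []            = refl
∣∪∣+∣∩∣ (outside ∷ σ) (outside ∷ τ) = ∣∪∣+∣∩∣ σ τ
∣∪∣+∣∩∣ (inside  ∷ σ) (outside ∷ τ) = cong suc (∣∪∣+∣∩∣ σ τ)
∣∪∣+∣∩∣ (outside ∷ σ) (inside  ∷ τ) = trans (cong suc (∣∪∣+∣∩∣ σ τ)) (sym (ℕP.+-suc ∣ σ ∣ ∣ τ ∣))
∣∪∣+∣∩∣ (inside  ∷ σ) (inside  ∷ τ) = begin
  suc (∣ σ ∪ τ ∣ ℕ.+ suc ∣ σ ∩ τ ∣) ≡⟨ cong suc (ℕP.+-suc ∣ σ ∪ τ ∣ ∣ σ ∩ τ ∣) ⟩
  suc (suc (∣ σ ∪ τ ∣ ℕ.+ ∣ σ ∩ τ ∣)) ≡⟨ cong (suc ∘ suc) (∣∪∣+∣∩∣ σ τ) ⟩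
  suc (suc (∣ σ ∣ ℕ.+ ∣ τ ∣))         ≡⟨ cong suc (ℕP.+-suc ∣ σ ∣ ∣ τ ∣) ⟨
  suc (∣ σ ∣ ℕ.+ suc ∣ τ ∣)           ∎
  where open ≡-Reasoning

⊆-∣∣-antisym : {σ τ : Subset n} → σ ⊆ τ → ∣ τ ∣ ≤ ∣ σ ∣ → σ ≡ τ
⊆-∣∣-antisym {σ = σ} {τ} σ⊆τ ∣τ∣≤∣σ∣ = ≟ˢ-true (trans (≟ˢ-as-⊆ σ τ)
  (cong₂ _∧_ (dec-true (σ ⊆? τ) σ⊆τ)
             (dec-true (∣ τ ∣ ℕP.≟ ∣ σ ∣) (ℕP.≤-antisym ∣τ∣≤∣σ∣ (p⊆q⇒∣p∣≤∣q∣ σ⊆τ)))))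

∣∪∣-> : {σ τ : Subset n} → σ ≢ τ → ∣ σ ∣ ≡ ∣ τ ∣ → ∣ σ ∣ ℕ.< ∣ σ ∪ τ ∣
∣∪∣-> {σ = σ} {τ} σ≢τ ∣σ∣≡∣τ∣ with ∣ σ ∪ τ ∣ ℕP.≤? ∣ σ ∣
... | no  ∣σ∪τ∣≰∣σ∣ = ℕP.≰⇒> ∣σ∪τ∣≰∣σ∣
... | yes ∣σ∪τ∣≤∣σ∣ = ⊥-elim (σ≢τ (trans σ≡σ∪τ (sym τ≡σ∪τ)))
  where
  σ≡σ∪τ : σ ≡ σ ∪ τ
  σ≡σ∪τ = ⊆-∣∣-antisym (p⊆p∪q τ) ∣σ∪τ∣≤∣σ∣
  τ≡σ∪τ : τ ≡ σ ∪ τ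
  τ≡σ∪τ = ⊆-∣∣-antisym (q⊆p∪q σ τ) (subst (∣ σ ∪ τ ∣ ≤_) ∣σ∣≡∣τ∣ ∣σ∪τ∣≤∣σ∣)

facets-∪ : {τ σ μ : Subset n} → facetᵇ τ μ ≡ true → facetᵇ σ μ ≡ true → τ ≢ σ → τ ∪ σ ≡ μ
facets-∪ {τ = τ} {σ} {μ} τ-facet σ-facet τ≢σ with facetᵇ-true τ μ τ-facet | facetᵇ-true σ μ σ-facet
... | τ⊆μ , ∣μ∣≡1+∣τ∣ | σ⊆μ , ∣μ∣≡1+∣σ∣ =
  ⊆-∣∣-antisym (λ x∈τ∪σ → [ τ⊆μ , σ⊆μ ]′ (x∈p∪q⁻ τ σ x∈τ∪σ)) (begin
    ∣ μ ∣       ≡⟨ ∣μ∣≡1+∣τ∣ ⟩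
    suc ∣ τ ∣   ≤⟨ ∣∪∣-> τ≢σ (ℕP.suc-injective (trans (sym ∣μ∣≡1+∣τ∣) ∣μ∣≡1+∣σ∣)) ⟩
    ∣ τ ∪ σ ∣   ∎)
  where open ℕP.≤-Reasoning

-- τ arises from σ by exchanging one vertex.
exchangeᵇ : Subset n → Subset n → Bool
exchangeᵇ σ τ = (∣ τ ∣ ≡ᵇ ∣ σ ∣) ∧ (suc ∣ σ ∩ τ ∣ ≡ᵇ ∣ σ ∣)

exchange-outside-inside : (σ τ : Subset n) → exchangeᵇ (outside ∷ σ) (inside ∷ τ) ≡ facetᵇ τ σ
exchange-outside-inside σ τ with suc ∣ τ ∣ ℕP.≟ ∣ σ ∣
... | yes 1+∣τ∣≡∣σ∣ = begin
  (suc ∣ τ ∣ ≡ᵇ ∣ σ ∣) ∧ (suc ∣ σ ∩ τ ∣ ≡ᵇ ∣ σ ∣)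
    ≡⟨ cong (_∧ (suc ∣ σ ∩ τ ∣ ≡ᵇ ∣ σ ∣)) (≡⇒≡ᵇ-true 1+∣τ∣≡∣σ∣) ⟩
  (suc ∣ σ ∩ τ ∣ ≡ᵇ ∣ σ ∣)  ≡⟨ cong (suc ∣ σ ∩ τ ∣ ≡ᵇ_) 1+∣τ∣≡∣σ∣ ⟨
  (∣ σ ∩ τ ∣ ≡ᵇ ∣ τ ∣)      ≡⟨ cong (λ ρ → ∣ ρ ∣ ≡ᵇ ∣ τ ∣) (∩-comm σ τ) ⟩
  (∣ τ ∩ σ ∣ ≡ᵇ ∣ τ ∣)      ≡⟨ facetᵇ-as-∩ τ σ (sym 1+∣τ∣≡∣σ∣) ⟨
  facetᵇ τ σ               ∎
  where open ≡-Reasoning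
... | no  1+∣τ∣≢∣σ∣ = begin
  (suc ∣ τ ∣ ≡ᵇ ∣ σ ∣) ∧ (suc ∣ σ ∩ τ ∣ ≡ᵇ ∣ σ ∣)
    ≡⟨ cong (_∧ (suc ∣ σ ∩ τ ∣ ≡ᵇ ∣ σ ∣)) (dec-false (suc ∣ τ ∣ ℕP.≟ ∣ σ ∣) 1+∣τ∣≢∣σ∣) ⟩
  false
    ≡⟨ BoolP.∧-zeroʳ (does (τ ⊆? σ)) ⟨
  does (τ ⊆? σ) ∧ false
    ≡⟨ cong (does (τ ⊆? σ) ∧_) (dec-false (∣ σ ∣ ℕP.≟ suc ∣ τ ∣) (1+∣τ∣≢∣σ∣ ∘ sym)) ⟨
  does (τ ⊆? σ) ∧ (∣ σ ∣ ≡ᵇ suc ∣ τ ∣)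
    ≡⟨ facetᵇ-as-⊆ τ σ ⟨
  facetᵇ τ σ ∎
  where open ≡-Reasoning

exchange-inside-outside : (σ τ : Subset n) → exchangeᵇ (inside ∷ σ) (outside ∷ τ) ≡ facetᵇ σ τ
exchange-inside-outside σ τ = trans (BoolP.∧-comm (∣ τ ∣ ≡ᵇ suc ∣ σ ∣) _)
  (sym (trans (facetᵇ-as-⊆ σ τ) (cong (_∧ (∣ τ ∣ ≡ᵇ suc ∣ σ ∣)) (⊆?-as-∩ σ τ))))

∈-∪-twice : {A B C : Subset n} {x : Fin n} → A ∪ B ≡ A ∪ C → x ∈ A ∪ B → x ∈ A ⊎ (x ∈ B × x ∈ C)
∈-∪-twice {A = A} {B} {C} {x} A∪B≡A∪C x∈A∪B with x ∈? A
... | yes x∈A = inj₁ x∈A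
... | no  x∉A = inj₂ (not-in-A (x∈p∪q⁻ A B x∈A∪B) , not-in-A (x∈p∪q⁻ A C (subst (x ∈_) A∪B≡A∪C x∈A∪B)))
  where
  not-in-A : ∀ {Y} → x ∈ A ⊎ x ∈ Y → x ∈ Y
  not-in-A = [ ⊥-elim ∘ x∉A , (λ x∈Y → x∈Y) ]′

-- Every vertex of A ∪ B = A ∪ C = B ∪ C lies in two of the three cliques,
-- and any two such pairs of cliques overlap.
∪-clique : (G : Graph n) {A B C : Subset n} → IsClique G A → IsClique G B → IsClique G C →
  A ∪ B ≡ A ∪ C → A ∪ B ≡ B ∪ C → IsClique G (A ∪ B)
∪-clique G {A} {B} {C} A-clique B-clique C-clique A∪B≡A∪C A∪B≡B∪C i j i∈ j∈ i≢j
  with ∈-∪-twice A∪B≡A∪C i∈ | ∈-∪-twice A∪B≡A∪C j∈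
... | inj₁ i∈A         | inj₁ j∈A         = A-clique i j i∈A j∈A i≢j
... | inj₂ (i∈B , _)   | inj₂ (j∈B , _)   = B-clique i j i∈B j∈B i≢j
... | inj₁ i∈A         | inj₂ (j∈B , j∈C) =
  [ (λ i∈B → B-clique i j i∈B j∈B i≢j) , (λ i∈C → C-clique i j i∈C j∈C i≢j) ]′
    (x∈p∪q⁻ B C (subst (i ∈_) A∪B≡B∪C (p⊆p∪q B i∈A)))
... | inj₂ (i∈B , i∈C) | inj₁ j∈A         =
  [ (λ j∈B → B-clique i j i∈B j∈B i≢j) , (λ j∈C → C-clique i j i∈C j∈C i≢j) ]′
    (x∈p∪q⁻ B C (subst (j ∈_) A∪B≡B∪C (p⊆p∪q B j∈A)))

-- Boundary coefficients and the full simplex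

private
  annihilate : ∀ a d → a ℤ.* 0ℤ ℤ.- d ≡ ℤ.- d
  annihilate = solve-∀
  neg*neg : ∀ a b → ℤ.- a ℤ.* ℤ.- b ≡ a ℤ.* b
  neg*neg = solve-∀
  neg*neg-comm : ∀ a b → ℤ.- a ℤ.* ℤ.- b ≡ b ℤ.* a
  neg*neg-comm = solve-∀
  *-neg-swap : ∀ a b → a ℤ.* ℤ.- b ≡ b ℤ.* ℤ.- a
  *-neg-swap = solve-∀
  neg-*-swap : ∀ a b → ℤ.- a ℤ.* b ≡ a ℤ.* ℤ.- b
  neg-*-swap = solve-∀

negOnePow² : ∀ j → negOnePow j ℤ.* negOnePow j ≡ 1ℤ
negOnePow² zero    = refl
negOnePow² (suc j) = trans (neg*neg (negOnePow j) (negOnePow j)) (negOnePow² j)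

∣negOnePow∣ : ∀ j → ℤ.∣ negOnePow j ∣ ≡ 1
∣negOnePow∣ zero    = refl
∣negOnePow∣ (suc j) = trans (ℤP.∣-i∣≡∣i∣ (negOnePow j)) (∣negOnePow∣ j)

bd-inside : (ρ σ : Subset n) → bd (inside ∷ ρ) (inside ∷ σ) ≡ ℤ.- bd ρ σ
bd-inside ρ σ with delPos ρ σ
... | just _  = refl
... | nothing = refl

bd-outside-inside : (ρ σ : Subset n) → bd (outside ∷ ρ) (inside ∷ σ) ≡ ℤ.- δℤ ρ σ
bd-outside-inside ρ σ with does (ρ ≟ˢ σ)
... | true  = refl
... | false = refl

bd² : (ρ σ : Subset n) → bd ρ σ ℤ.* bd ρ σ ≡ 𝟙 (facetᵇ ρ σ)
bd² ρ σ with delPos ρ σ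
... | just j  = negOnePow² (suc j)
... | nothing = refl

bd²≥0 : (ρ σ : Subset n) → 0ℤ ℤ.≤ bd ρ σ ℤ.* bd ρ σ
bd²≥0 ρ σ = subst (0ℤ ℤ.≤_) (sym (bd² ρ σ)) (𝟙-≥0 (facetᵇ ρ σ))

∣bd∣ : (ρ σ : Subset n) → + ℤ.∣ bd ρ σ ∣ ≡ 𝟙 (facetᵇ ρ σ)
∣bd∣ ρ σ with delPos ρ σ
... | just j  = cong +_ (∣negOnePow∣ (suc j))
... | nothing = refl

bd-nonfacet : (ρ σ : Subset n) → facetᵇ ρ σ ≡ false → bd ρ σ ≡ 0ℤ
bd-nonfacet ρ σ _ with delPos ρ σ
bd-nonfacet ρ σ _  | nothing = refl
bd-nonfacet ρ σ () | just _

-- Entries of ∂ᵀ∂ and ∂∂ᵀ for the full simplex on Fin n: the sums run over all subsets.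
down up : Subset n → Subset n → ℤ
down τ σ = ∑ (λ ρ → bd ρ τ ℤ.* bd ρ σ)
up   τ σ = ∑ (λ μ → bd τ μ ℤ.* bd σ μ)

module _ (τ σ : Subset n) where

  down-outside-outside : down (outside ∷ τ) (outside ∷ σ) ≡ down τ σ
  down-outside-outside = ∑-outside {n} _ (λ _ → refl)

  down-inside-inside : down (inside ∷ τ) (inside ∷ σ) ≡ δℤ τ σ ℤ.+ down τ σ
  down-inside-inside = trans (∑-∷ {n} _)
    (cong₂ ℤ._+_ (trans (∑-cong outside-term) (∑-δ τ (λ ρ → δℤ ρ σ))) (∑-cong inside-term))
    where
    outside-term : ∀ ρ →
      bd (outside ∷ ρ) (inside ∷ τ) ℤ.* bd (outside ∷ ρ) (inside ∷ σ) ≡ δℤ ρ τ ℤ.* δℤ ρ σ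
    outside-term ρ = trans (cong₂ ℤ._*_ (bd-outside-inside ρ τ) (bd-outside-inside ρ σ))
                           (neg*neg (δℤ ρ τ) (δℤ ρ σ))
    inside-term : ∀ ρ → bd (inside ∷ ρ) (inside ∷ τ) ℤ.* bd (inside ∷ ρ) (inside ∷ σ) ≡ bd ρ τ ℤ.* bd ρ σ
    inside-term ρ = trans (cong₂ ℤ._*_ (bd-inside ρ τ) (bd-inside ρ σ)) (neg*neg (bd ρ τ) (bd ρ σ))

  down-outside-inside : down (outside ∷ τ) (inside ∷ σ) ≡ ℤ.- bd σ τ
  down-outside-inside =
    trans (∑-outside {n} _ (λ _ → refl)) (trans (∑-cong outside-term) (∑-δ σ (λ ρ → ℤ.- bd ρ τ)))
    where
    outside-term : ∀ ρ → bd ρ τ ℤ.* bd (outside ∷ ρ) (inside ∷ σ) ≡ δℤ ρ σ ℤ.* ℤ.- bd ρ τ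
    outside-term ρ = trans (cong (bd ρ τ ℤ.*_) (bd-outside-inside ρ σ)) (*-neg-swap (bd ρ τ) (δℤ ρ σ))

  down-inside-outside : down (inside ∷ τ) (outside ∷ σ) ≡ ℤ.- bd τ σ
  down-inside-outside =
    trans (∑-outside {n} _ (λ ρ → ℤP.*-zeroʳ (bd (inside ∷ ρ) (inside ∷ τ))))
          (trans (∑-cong outside-term) (∑-δ τ (λ ρ → ℤ.- bd ρ σ)))
    where
    outside-term : ∀ ρ → bd (outside ∷ ρ) (inside ∷ τ) ℤ.* bd ρ σ ≡ δℤ ρ τ ℤ.* ℤ.- bd ρ σ
    outside-term ρ = trans (cong (ℤ._* bd ρ σ) (bd-outside-inside ρ τ)) (neg-*-swap (δℤ ρ τ) (bd ρ σ))

  up-outside-outside : up (outside ∷ τ) (outside ∷ σ) ≡ up τ σ ℤ.+ δℤ τ σ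
  up-outside-outside = trans (∑-∷ {n} _) (cong (ℤ._+_ (up τ σ))
    (trans (∑-cong inside-term) (trans (∑-δ τ (δℤ σ)) (δℤ-sym σ τ))))
    where
    inside-term : ∀ μ →
      bd (outside ∷ τ) (inside ∷ μ) ℤ.* bd (outside ∷ σ) (inside ∷ μ) ≡ δℤ μ τ ℤ.* δℤ σ μ
    inside-term μ = trans (cong₂ ℤ._*_ (bd-outside-inside τ μ) (bd-outside-inside σ μ))
                          (trans (neg*neg (δℤ τ μ) (δℤ σ μ)) (cong (ℤ._* δℤ σ μ) (δℤ-sym τ μ)))

  up-inside-inside : up (inside ∷ τ) (inside ∷ σ) ≡ up τ σ
  up-inside-inside = trans (∑-inside {n} _ (λ _ → refl)) (∑-cong inside-term)
    where
    inside-term : ∀ μ → bd (inside ∷ τ) (inside ∷ μ) ℤ.* bd (inside ∷ σ) (inside ∷ μ) ≡ bd τ μ ℤ.* bd σ μ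
    inside-term μ = trans (cong₂ ℤ._*_ (bd-inside τ μ) (bd-inside σ μ)) (neg*neg (bd τ μ) (bd σ μ))

  up-outside-inside : up (outside ∷ τ) (inside ∷ σ) ≡ bd σ τ
  up-outside-inside =
    trans (∑-inside {n} _ (λ μ → ℤP.*-zeroʳ (bd τ μ))) (trans (∑-cong inside-term) (∑-δ τ (bd σ)))
    where
    inside-term : ∀ μ →
      bd (outside ∷ τ) (inside ∷ μ) ℤ.* bd (inside ∷ σ) (inside ∷ μ) ≡ δℤ μ τ ℤ.* bd σ μ
    inside-term μ = trans (cong₂ ℤ._*_ (bd-outside-inside τ μ) (bd-inside σ μ))
                          (trans (neg*neg (δℤ τ μ) (bd σ μ)) (cong (ℤ._* bd σ μ) (δℤ-sym τ μ)))

  up-inside-outside : up (inside ∷ τ) (outside ∷ σ) ≡ bd τ σ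
  up-inside-outside = trans (∑-inside {n} _ (λ _ → refl)) (trans (∑-cong inside-term) (∑-δ σ (bd τ)))
    where
    inside-term : ∀ μ →
      bd (inside ∷ τ) (inside ∷ μ) ℤ.* bd (outside ∷ σ) (inside ∷ μ) ≡ δℤ μ σ ℤ.* bd τ μ
    inside-term μ = trans (cong₂ ℤ._*_ (bd-inside τ μ) (bd-outside-inside σ μ))
                          (trans (neg*neg-comm (bd τ μ) (δℤ σ μ)) (cong (ℤ._* bd τ μ) (δℤ-sym σ μ)))

down+up : (τ σ : Subset n) → down τ σ ℤ.+ up τ σ ≡ + n ℤ.* δℤ τ σ
down+up []          []          = refl
down+up {suc n} (outside ∷ τ) (outside ∷ σ) = begin
  down (outside ∷ τ) (outside ∷ σ) ℤ.+ up (outside ∷ τ) (outside ∷ σ)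
    ≡⟨ cong₂ ℤ._+_ (down-outside-outside τ σ) (up-outside-outside τ σ) ⟩
  down τ σ ℤ.+ (up τ σ ℤ.+ δℤ τ σ)  ≡⟨ ℤP.+-assoc (down τ σ) _ _ ⟨
  down τ σ ℤ.+ up τ σ ℤ.+ δℤ τ σ    ≡⟨ cong (ℤ._+ δℤ τ σ) (down+up τ σ) ⟩
  + n ℤ.* δℤ τ σ ℤ.+ δℤ τ σ         ≡⟨ suc-* (+ n) (δℤ τ σ) ⟩
  + suc n ℤ.* δℤ τ σ                ∎
  where
  open ≡-Reasoning
  suc-* : ∀ a d → a ℤ.* d ℤ.+ d ≡ (1ℤ ℤ.+ a) ℤ.* d
  suc-* = solve-∀
down+up {suc n} (inside ∷ τ) (inside ∷ σ) = begin
  down (inside ∷ τ) (inside ∷ σ) ℤ.+ up (inside ∷ τ) (inside ∷ σ)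
    ≡⟨ cong₂ ℤ._+_ (down-inside-inside τ σ) (up-inside-inside τ σ) ⟩
  δℤ τ σ ℤ.+ down τ σ ℤ.+ up τ σ    ≡⟨ ℤP.+-assoc (δℤ τ σ) _ _ ⟩
  δℤ τ σ ℤ.+ (down τ σ ℤ.+ up τ σ)  ≡⟨ cong (ℤ._+_ (δℤ τ σ)) (down+up τ σ) ⟩
  δℤ τ σ ℤ.+ + n ℤ.* δℤ τ σ         ≡⟨ suc-* (+ n) (δℤ τ σ) ⟩
  + suc n ℤ.* δℤ τ σ                ∎
  where
  open ≡-Reasoning
  suc-* : ∀ a d → d ℤ.+ a ℤ.* d ≡ (1ℤ ℤ.+ a) ℤ.* d
  suc-* = solve-∀
down+up {suc n} (outside ∷ τ) (inside ∷ σ) =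
  trans (cong₂ ℤ._+_ (down-outside-inside τ σ) (up-outside-inside τ σ))
        (trans (ℤP.+-inverseˡ (bd σ τ)) (sym (ℤP.*-zeroʳ (+ suc n))))
down+up {suc n} (inside ∷ τ) (outside ∷ σ) =
  trans (cong₂ ℤ._+_ (down-inside-outside τ σ) (up-inside-outside τ σ))
        (trans (ℤP.+-inverseˡ (bd τ σ)) (sym (ℤP.*-zeroʳ (+ suc n))))

down-diag : (σ : Subset n) → down σ σ ≡ + ∣ σ ∣
down-diag []            = refl
down-diag (outside ∷ σ) = trans (down-outside-outside σ σ) (down-diag σ)
down-diag (inside ∷ σ)  =
  trans (down-inside-inside σ σ) (cong₂ ℤ._+_ (δℤ-refl σ) (down-diag σ))

up-diag : (σ : Subset n) → up σ σ ≡ + n ℤ.- + ∣ σ ∣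
up-diag {n} σ = begin
  up σ σ                              ≡⟨ difference (down σ σ) (up σ σ) ⟩
  (down σ σ ℤ.+ up σ σ) ℤ.- down σ σ  ≡⟨ cong₂ ℤ._-_ (down+up σ σ) (down-diag σ) ⟩
  + n ℤ.* δℤ σ σ ℤ.- + ∣ σ ∣           ≡⟨ cong (λ d → + n ℤ.* d ℤ.- + ∣ σ ∣) (δℤ-refl σ) ⟩
  + n ℤ.* 1ℤ ℤ.- + ∣ σ ∣               ≡⟨ cong (ℤ._- + ∣ σ ∣) (ℤP.*-identityʳ (+ n)) ⟩
  + n ℤ.- + ∣ σ ∣                      ∎
  where
  open ≡-Reasoning
  difference : ∀ d u → u ≡ (d ℤ.+ u) ℤ.- d
  difference = solve-∀

up-off : {τ σ : Subset n} → τ ≢ σ → up τ σ ≡ ℤ.- down τ σ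
up-off {n} {τ} {σ} τ≢σ = begin
  up τ σ                              ≡⟨ difference (down τ σ) (up τ σ) ⟩
  (down τ σ ℤ.+ up τ σ) ℤ.- down τ σ  ≡⟨ cong (ℤ._- down τ σ) (down+up τ σ) ⟩
  + n ℤ.* δℤ τ σ ℤ.- down τ σ         ≡⟨ cong (λ d → + n ℤ.* d ℤ.- down τ σ) (δℤ-≢ τ≢σ) ⟩
  + n ℤ.* 0ℤ ℤ.- down τ σ             ≡⟨ annihilate (+ n) (down τ σ) ⟩
  ℤ.- down τ σ                        ∎
  where
  open ≡-Reasoning
  difference : ∀ d u → u ≡ (d ℤ.+ u) ℤ.- d
  difference = solve-∀

∑-facets : (σ : Subset n) → ∑ (λ ρ → 𝟙 (facetᵇ ρ σ)) ≡ + ∣ σ ∣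
∑-facets σ = trans (∑-cong (λ ρ → sym (bd² ρ σ))) (down-diag σ)

∑-cofacets : (σ : Subset n) → ∑ (λ μ → 𝟙 (facetᵇ σ μ)) ≡ + n ℤ.- + ∣ σ ∣
∑-cofacets σ = trans (∑-cong (λ μ → sym (bd² σ μ))) (up-diag σ)

∣down∣-off : (τ σ : Subset n) → τ ≢ σ → ∣ τ ∣ ≡ ∣ σ ∣ → + ℤ.∣ down τ σ ∣ ≡ 𝟙 (suc ∣ σ ∩ τ ∣ ≡ᵇ ∣ σ ∣)
∣down∣-off []            []            τ≢σ _ = ⊥-elim (τ≢σ refl)
∣down∣-off (outside ∷ τ) (outside ∷ σ) τ≢σ ∣τ∣≡∣σ∣ =
  trans (cong (+_ ∘ ℤ.∣_∣) (down-outside-outside τ σ)) (∣down∣-off τ σ (τ≢σ ∘ cong (outside ∷_)) ∣τ∣≡∣σ∣)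
∣down∣-off (inside ∷ τ)  (inside ∷ σ)  τ≢σ ∣τ∣≡∣σ∣ = begin
  + ℤ.∣ down (inside ∷ τ) (inside ∷ σ) ∣  ≡⟨ cong (+_ ∘ ℤ.∣_∣) (down-inside-inside τ σ) ⟩
  + ℤ.∣ δℤ τ σ ℤ.+ down τ σ ∣             ≡⟨ cong (λ d → + ℤ.∣ d ℤ.+ down τ σ ∣) (δℤ-≢ τ≢σ′) ⟩
  + ℤ.∣ 0ℤ ℤ.+ down τ σ ∣                 ≡⟨ cong (+_ ∘ ℤ.∣_∣) (ℤP.+-identityˡ (down τ σ)) ⟩
  + ℤ.∣ down τ σ ∣                        ≡⟨ ∣down∣-off τ σ τ≢σ′ (ℕP.suc-injective ∣τ∣≡∣σ∣) ⟩
  𝟙 (suc ∣ σ ∩ τ ∣ ≡ᵇ ∣ σ ∣)              ∎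
  where
  open ≡-Reasoning
  τ≢σ′ : τ ≢ σ
  τ≢σ′ = τ≢σ ∘ cong (inside ∷_)
∣down∣-off (outside ∷ τ) (inside ∷ σ)  _ ∣τ∣≡1+∣σ∣ = begin
  + ℤ.∣ down (outside ∷ τ) (inside ∷ σ) ∣ ≡⟨ cong (+_ ∘ ℤ.∣_∣) (down-outside-inside τ σ) ⟩
  + ℤ.∣ ℤ.- bd σ τ ∣                      ≡⟨ cong +_ (ℤP.∣-i∣≡∣i∣ (bd σ τ)) ⟩
  + ℤ.∣ bd σ τ ∣                          ≡⟨ ∣bd∣ σ τ ⟩
  𝟙 (facetᵇ σ τ)                         ≡⟨ cong 𝟙 (facetᵇ-as-∩ σ τ ∣τ∣≡1+∣σ∣) ⟩
  𝟙 (∣ σ ∩ τ ∣ ≡ᵇ ∣ σ ∣)                  ∎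
  where open ≡-Reasoning
∣down∣-off (inside ∷ τ)  (outside ∷ σ) _ 1+∣τ∣≡∣σ∣ = begin
  + ℤ.∣ down (inside ∷ τ) (outside ∷ σ) ∣ ≡⟨ cong (+_ ∘ ℤ.∣_∣) (down-inside-outside τ σ) ⟩
  + ℤ.∣ ℤ.- bd τ σ ∣                      ≡⟨ cong +_ (ℤP.∣-i∣≡∣i∣ (bd τ σ)) ⟩
  + ℤ.∣ bd τ σ ∣                          ≡⟨ ∣bd∣ τ σ ⟩
  𝟙 (facetᵇ τ σ)                         ≡⟨ cong 𝟙 (facetᵇ-as-∩ τ σ (sym 1+∣τ∣≡∣σ∣)) ⟩
  𝟙 (∣ τ ∩ σ ∣ ≡ᵇ ∣ τ ∣)                  ≡⟨ cong (λ ρ → 𝟙 (∣ ρ ∣ ≡ᵇ ∣ τ ∣)) (∩-comm τ σ) ⟩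
  𝟙 (suc ∣ σ ∩ τ ∣ ≡ᵇ suc ∣ τ ∣)          ≡⟨ cong (λ m → 𝟙 (suc ∣ σ ∩ τ ∣ ≡ᵇ m)) 1+∣τ∣≡∣σ∣ ⟩
  𝟙 (suc ∣ σ ∩ τ ∣ ≡ᵇ ∣ σ ∣)              ∎
  where open ≡-Reasoning

∑-exchange : (σ : Subset n) → ∑ (λ τ → 𝟙 (exchangeᵇ σ τ)) ≡ + ∣ σ ∣ ℤ.* (+ n ℤ.- + ∣ σ ∣)
∑-exchange []            = refl
∑-exchange {suc n} (outside ∷ σ) = begin
  ∑ (λ τ → 𝟙 (exchangeᵇ (outside ∷ σ) τ))
    ≡⟨ ∑-∷ {n} _ ⟩
  ∑ (λ τ → 𝟙 (exchangeᵇ σ τ)) ℤ.+ ∑ (λ τ → 𝟙 (exchangeᵇ (outside ∷ σ) (inside ∷ τ)))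
    ≡⟨ cong₂ ℤ._+_ (∑-exchange σ) (trans (∑-cong (cong 𝟙 ∘ exchange-outside-inside σ)) (∑-facets σ)) ⟩
  + ∣ σ ∣ ℤ.* (+ n ℤ.- + ∣ σ ∣) ℤ.+ + ∣ σ ∣
    ≡⟨ grow (+ ∣ σ ∣) (+ n) ⟩
  + ∣ σ ∣ ℤ.* (+ suc n ℤ.- + ∣ σ ∣) ∎
  where
  open ≡-Reasoning
  grow : ∀ s m → s ℤ.* (m ℤ.- s) ℤ.+ s ≡ s ℤ.* ((1ℤ ℤ.+ m) ℤ.- s)
  grow = solve-∀
∑-exchange {suc n} (inside ∷ σ) = begin
  ∑ (λ τ → 𝟙 (exchangeᵇ (inside ∷ σ) τ))
    ≡⟨ ∑-∷ {n} _ ⟩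
  ∑ (λ τ → 𝟙 (exchangeᵇ (inside ∷ σ) (outside ∷ τ))) ℤ.+ ∑ (λ τ → 𝟙 (exchangeᵇ σ τ))
    ≡⟨ cong₂ ℤ._+_ (trans (∑-cong (cong 𝟙 ∘ exchange-inside-outside σ)) (∑-cofacets σ)) (∑-exchange σ) ⟩
  (+ n ℤ.- + ∣ σ ∣) ℤ.+ + ∣ σ ∣ ℤ.* (+ n ℤ.- + ∣ σ ∣)
    ≡⟨ grow (+ ∣ σ ∣) (+ n) ⟩
  (1ℤ ℤ.+ + ∣ σ ∣) ℤ.* ((1ℤ ℤ.+ + n) ℤ.- (1ℤ ℤ.+ + ∣ σ ∣)) ∎
  where
  open ≡-Reasoning
  grow : ∀ s m → (m ℤ.- s) ℤ.+ s ℤ.* (m ℤ.- s) ≡ (1ℤ ℤ.+ s) ℤ.* ((1ℤ ℤ.+ m) ℤ.- (1ℤ ℤ.+ s))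
  grow = solve-∀

-- The Laplacian of Γ and the simplex graph

faceᵇ : SimplicialComplex n → ℕ → Subset n → Bool
faceᵇ Γ m ρ = mem Γ ρ ∧ (∣ ρ ∣ ≡ᵇ m)

-- The up part of Δ Γ k: only common cofacets of τ and σ contribute, so no size condition on μ is needed.
upΓ : SimplicialComplex n → Subset n → Subset n → ℤ
upΓ Γ τ σ = ∑ (λ μ → 𝟙 (mem Γ μ) ℤ.* (bd τ μ ℤ.* bd σ μ))

module _ (Γ : SimplicialComplex n) where

  sum-facesOfSize : ∀ m (f : Subset n → ℤ) →
    sumℤ (map f (facesOfSize Γ m)) ≡ ∑ (λ ρ → 𝟙 (faceᵇ Γ m ρ) ℤ.* f ρ)
  sum-facesOfSize m f = trans (sum-map-filter _ f (allSubsets n))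
    (∑-cong (λ ρ → cong (λ b → 𝟙 b ℤ.* f ρ) (does-≟-true (faceᵇ Γ m ρ))))

  count-facesOfSize : ∀ m {P : Subset n → Set} (P? : ∀ ρ → Dec (P ρ)) →
    + length (filter P? (facesOfSize Γ m)) ≡ ∑ (λ ρ → 𝟙 (faceᵇ Γ m ρ) ℤ.* 𝟙 (does (P? ρ)))
  count-facesOfSize m P? = trans (length-filter P? (facesOfSize Γ m)) (sum-facesOfSize m _)

  sum-facesOfSize-cong : ∀ m {f g : Subset n → ℤ} → (∀ ρ → faceᵇ Γ m ρ ≡ true → f ρ ≡ g ρ) →
    sumℤ (map f (facesOfSize Γ m)) ≡ sumℤ (map g (facesOfSize Γ m))
  sum-facesOfSize-cong m {f} {g} f≡g = begin
    sumℤ (map f (facesOfSize Γ m))          ≡⟨ sum-facesOfSize m f ⟩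
    ∑ (λ ρ → 𝟙 (faceᵇ Γ m ρ) ℤ.* f ρ)       ≡⟨ ∑-cong (λ ρ → 𝟙-*-cong (faceᵇ Γ m ρ) (f≡g ρ)) ⟩
    ∑ (λ ρ → 𝟙 (faceᵇ Γ m ρ) ℤ.* g ρ)       ≡⟨ sum-facesOfSize m g ⟨
    sumℤ (map g (facesOfSize Γ m))          ∎
    where open ≡-Reasoning

  sum-δℤ-simplices : ∀ {k σ} → IsSimplex Γ k σ → sumℤ (map (λ τ → δℤ τ σ) (S Γ k)) ≡ 1ℤ
  sum-δℤ-simplices {k} {σ} (σ∈Γ , ∣σ∣≡1+k) = begin
    sumℤ (map (λ τ → δℤ τ σ) (S Γ k))              ≡⟨ sum-facesOfSize (suc k) _ ⟩
    ∑ (λ τ → 𝟙 (faceᵇ Γ (suc k) τ) ℤ.* δℤ τ σ)     ≡⟨ ∑-cong (λ τ → ℤP.*-comm _ (δℤ τ σ)) ⟩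
    ∑ (λ τ → δℤ τ σ ℤ.* 𝟙 (faceᵇ Γ (suc k) τ))     ≡⟨ ∑-δ σ (𝟙 ∘ faceᵇ Γ (suc k)) ⟩
    𝟙 (faceᵇ Γ (suc k) σ)                          ≡⟨ cong 𝟙 (cong₂ _∧_ σ∈Γ (≡⇒≡ᵇ-true ∣σ∣≡1+k)) ⟩
    1ℤ                                             ∎
    where open ≡-Reasoning

  simplex : ∀ {k τ} → faceᵇ Γ (suc k) τ ≡ true → IsSimplex Γ k τ
  simplex {k} {τ} face =
    BoolP.∧-conicalˡ (mem Γ τ) _ face , ≡ᵇ-true⇒≡ (BoolP.∧-conicalʳ (mem Γ τ) _ face)

  facet-of-simplex : ∀ {k ρ τ} → IsSimplex Γ k τ → facetᵇ ρ τ ≡ true → faceᵇ Γ k ρ ≡ true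
  facet-of-simplex {ρ = ρ} {τ} (τ∈Γ , ∣τ∣≡1+k) is-facet with facetᵇ-true ρ τ is-facet
  ... | ρ⊆τ , ∣τ∣≡1+∣ρ∣ =
    cong₂ _∧_ (closed Γ ρ⊆τ τ∈Γ) (≡⇒≡ᵇ-true (ℕP.suc-injective (trans (sym ∣τ∣≡1+∣ρ∣) ∣τ∣≡1+k)))

  Δ-as-down+upΓ : ∀ {k τ} σ → IsSimplex Γ k τ → Δ Γ k τ σ ≡ down τ σ ℤ.+ upΓ Γ τ σ
  Δ-as-down+upΓ {k} {τ} σ τ-simplex@(_ , ∣τ∣≡1+k) = cong₂ ℤ._+_
    (trans (sum-facesOfSize k _) (∑-cong (λ ρ → 𝟙-*-redundant _ (down-vanishes ρ))))
    (trans (sum-facesOfSize (suc (suc k)) _) (∑-cong (λ μ → 𝟙-∧-* (mem Γ μ) _ (up-vanishes μ))))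
    where
    down-vanishes : ∀ ρ → faceᵇ Γ k ρ ≡ false → bd ρ τ ℤ.* bd ρ σ ≡ 0ℤ
    down-vanishes ρ not-face with facetᵇ ρ τ in is-facet
    ... | false = cong (ℤ._* bd ρ σ) (bd-nonfacet ρ τ is-facet)
    ... | true  with () ← trans (sym (facet-of-simplex τ-simplex is-facet)) not-face
    cofacet-size : ∀ {μ} → facetᵇ τ μ ≡ true → ∣ μ ∣ ≡ suc (suc k)
    cofacet-size {μ} is-facet = trans (proj₂ (facetᵇ-true τ μ is-facet)) (cong suc ∣τ∣≡1+k)
    up-vanishes : ∀ μ → (∣ μ ∣ ≡ᵇ suc (suc k)) ≡ false → bd τ μ ℤ.* bd σ μ ≡ 0ℤ
    up-vanishes μ wrong-size with facetᵇ τ μ in is-facet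
    ... | false = cong (ℤ._* bd σ μ) (bd-nonfacet τ μ is-facet)
    ... | true  with () ← trans (sym (≡⇒≡ᵇ-true (cofacet-size is-facet))) wrong-size

  upΓ-diag : ∀ {k σ} → IsSimplex Γ k σ → upΓ Γ σ σ ≡ + dup Γ k σ
  upΓ-diag {k} {σ} (_ , ∣σ∣≡1+k) =
    sym (trans (count-facesOfSize (suc (suc k)) (σ ⊆?_)) (∑-cong same-term))
    where
    same-term : ∀ μ →
      𝟙 (faceᵇ Γ (suc (suc k)) μ) ℤ.* 𝟙 (does (σ ⊆? μ)) ≡ 𝟙 (mem Γ μ) ℤ.* (bd σ μ ℤ.* bd σ μ)
    same-term μ = begin
      𝟙 (faceᵇ Γ (suc (suc k)) μ) ℤ.* 𝟙 (does (σ ⊆? μ))    ≡⟨ 𝟙-∧-shuffle (mem Γ μ) _ _ ⟩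
      𝟙 (mem Γ μ) ℤ.* 𝟙 (does (σ ⊆? μ) ∧ (∣ μ ∣ ≡ᵇ suc (suc k)))
        ≡⟨ cong (λ m → 𝟙 (mem Γ μ) ℤ.* 𝟙 (does (σ ⊆? μ) ∧ (∣ μ ∣ ≡ᵇ suc m))) ∣σ∣≡1+k ⟨
      𝟙 (mem Γ μ) ℤ.* 𝟙 (does (σ ⊆? μ) ∧ (∣ μ ∣ ≡ᵇ suc ∣ σ ∣))
        ≡⟨ cong (𝟙 (mem Γ μ) ℤ.*_) (trans (cong 𝟙 (sym (facetᵇ-as-⊆ σ μ))) (sym (bd² σ μ))) ⟩
      𝟙 (mem Γ μ) ℤ.* (bd σ μ ℤ.* bd σ μ)                   ∎
      where open ≡-Reasoning

  Δ-diag : ∀ {k σ} → IsSimplex Γ k σ → Δ Γ k σ σ ≡ + suc k ℤ.+ + dup Γ k σ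
  Δ-diag {σ = σ} σ-simplex@(_ , ∣σ∣≡1+k) = trans (Δ-as-down+upΓ σ σ-simplex)
    (cong₂ ℤ._+_ (trans (down-diag σ) (cong +_ ∣σ∣≡1+k)) (upΓ-diag σ-simplex))

  -- Two distinct simplices have at most one common cofacet, namely their union.
  upΓ-off : {τ σ : Subset n} → τ ≢ σ → upΓ Γ τ σ ≡ 𝟙 (mem Γ (τ ∪ σ)) ℤ.* up τ σ
  upΓ-off {τ} {σ} τ≢σ =
    trans (∑-cong same-term) (sum-map-*ˡ (𝟙 (mem Γ (τ ∪ σ))) (λ μ → bd τ μ ℤ.* bd σ μ) (allSubsets n))
    where
    same-term : ∀ μ → 𝟙 (mem Γ μ) ℤ.* (bd τ μ ℤ.* bd σ μ) ≡ 𝟙 (mem Γ (τ ∪ σ)) ℤ.* (bd τ μ ℤ.* bd σ μ)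
    same-term μ with facetᵇ τ μ in τ-facet | facetᵇ σ μ in σ-facet
    ... | true  | true  = cong (λ ν → 𝟙 (mem Γ ν) ℤ.* (bd τ μ ℤ.* bd σ μ))
                            (sym (facets-∪ τ-facet σ-facet τ≢σ))
    ... | false | _     = *-cong-0 (𝟙 (mem Γ μ)) (𝟙 (mem Γ (τ ∪ σ)))
                            (cong (ℤ._* bd σ μ) (bd-nonfacet τ μ τ-facet))
    ... | true  | false = *-cong-0 (𝟙 (mem Γ μ)) (𝟙 (mem Γ (τ ∪ σ)))
                            (trans (cong (bd τ μ ℤ.*_) (bd-nonfacet σ μ σ-facet)) (ℤP.*-zeroʳ (bd τ μ)))

  Δ-off : ∀ {k τ σ} → IsSimplex Γ k τ → τ ≢ σ → Δ Γ k τ σ ≡ 𝟙 (not (mem Γ (τ ∪ σ))) ℤ.* down τ σ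
  Δ-off {τ = τ} {σ} τ-simplex τ≢σ = begin
    Δ Γ _ τ σ                               ≡⟨ Δ-as-down+upΓ σ τ-simplex ⟩
    down τ σ ℤ.+ upΓ Γ τ σ                  ≡⟨ cong (ℤ._+_ (down τ σ)) (upΓ-off τ≢σ) ⟩
    down τ σ ℤ.+ 𝟙 b ℤ.* up τ σ             ≡⟨ cong (λ u → down τ σ ℤ.+ 𝟙 b ℤ.* u) (up-off τ≢σ) ⟩
    down τ σ ℤ.+ 𝟙 b ℤ.* ℤ.- down τ σ       ≡⟨ 𝟙-not-* b (down τ σ) ⟩
    𝟙 (not b) ℤ.* down τ σ                  ∎
    where
    open ≡-Reasoning
    b : Bool
    b = mem Γ (τ ∪ σ)

  ∣Δ∣-off : ∀ {k τ σ} → IsSimplex Γ k τ → IsSimplex Γ k σ → τ ≢ σ → + ℤ.∣ Δ Γ k τ σ ∣ ≡ 𝟙 (adjᵇ Γ k σ τ)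
  ∣Δ∣-off {k} {τ} {σ} τ-simplex@(_ , ∣τ∣≡1+k) (_ , ∣σ∣≡1+k) τ≢σ = begin
    + ℤ.∣ Δ Γ k τ σ ∣
      ≡⟨ cong (+_ ∘ ℤ.∣_∣) (Δ-off τ-simplex τ≢σ) ⟩
    + ℤ.∣ 𝟙 (not b) ℤ.* down τ σ ∣
      ≡⟨ ∣𝟙*∣ (not b) (down τ σ) ⟩
    𝟙 (not b) ℤ.* + ℤ.∣ down τ σ ∣
      ≡⟨ cong (𝟙 (not b) ℤ.*_) (∣down∣-off τ σ τ≢σ (trans ∣τ∣≡1+k (sym ∣σ∣≡1+k))) ⟩
    𝟙 (not b) ℤ.* 𝟙 (suc ∣ σ ∩ τ ∣ ≡ᵇ ∣ σ ∣)
      ≡⟨ cong (λ s → 𝟙 (not b) ℤ.* 𝟙 (suc ∣ σ ∩ τ ∣ ≡ᵇ s)) ∣σ∣≡1+k ⟩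
    𝟙 (not b) ℤ.* 𝟙 (∣ σ ∩ τ ∣ ≡ᵇ k)
      ≡⟨ trans (ℤP.*-comm (𝟙 (not b)) _) (sym (𝟙-∧ _ (not b))) ⟩
    𝟙 ((∣ σ ∩ τ ∣ ≡ᵇ k) ∧ not b)
      ≡⟨ cong₂ (λ e ν → 𝟙 (not e ∧ (∣ σ ∩ τ ∣ ≡ᵇ k) ∧ not (mem Γ ν))) (≟ˢ-≢ (τ≢σ ∘ sym)) (∪-comm σ τ) ⟨
    𝟙 (adjᵇ Γ k σ τ)
      ∎
    where
    open ≡-Reasoning
    b : Bool
    b = mem Γ (τ ∪ σ)

  dup-bound : ∀ {k σ} → IsSimplex Γ k σ → + dup Γ k σ ℤ.≤ + n ℤ.- + suc k
  dup-bound {k} {σ} σ-simplex@(_ , ∣σ∣≡1+k) = begin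
    + dup Γ _ σ         ≡⟨ upΓ-diag σ-simplex ⟨
    upΓ Γ σ σ           ≤⟨ ∑-mono-≤ {n} (λ μ → 𝟙-*-≤ (mem Γ μ) (bd²≥0 σ μ)) ⟩
    up σ σ              ≡⟨ up-diag σ ⟩
    + n ℤ.- + ∣ σ ∣     ≡⟨ cong (λ s → + n ℤ.- + s) ∣σ∣≡1+k ⟩
    + n ℤ.- + suc k     ∎
    where open ℤP.≤-Reasoning

  adjᵇ-irrefl : ∀ {k} σ → adjᵇ Γ k σ σ ≡ false
  adjᵇ-irrefl {k} σ = cong (λ b → not b ∧ (∣ σ ∩ σ ∣ ≡ᵇ k) ∧ not (mem Γ (σ ∪ σ))) (≟ˢ-refl σ)

  deg-as-sum : ∀ k σ → + deg Γ k σ ≡ sumℤ (map (λ τ → 𝟙 (adjᵇ Γ k σ τ)) (S Γ k))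
  deg-as-sum k σ = trans (length-filter _ (S Γ k))
    (cong sumℤ (ListP.map-cong (λ τ → cong 𝟙 (does-≟-true (adjᵇ Γ k σ τ))) (S Γ k)))

  deg-as-∑ : ∀ k σ → + deg Γ k σ ≡ ∑ (λ τ → 𝟙 (faceᵇ Γ (suc k) τ ∧ adjᵇ Γ k σ τ))
  deg-as-∑ k σ = trans (count-facesOfSize (suc k) (λ τ → adjᵇ Γ k σ τ BoolP.≟ true)) (∑-cong (λ τ →
    trans (cong (λ b → 𝟙 (faceᵇ Γ (suc k) τ) ℤ.* 𝟙 b) (does-≟-true (adjᵇ Γ k σ τ)))
          (sym (𝟙-∧ (faceᵇ Γ (suc k) τ) (adjᵇ Γ k σ τ)))))

  record Neighbour (k : ℕ) (σ τ : Subset n) : Set where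
    field
      τ∈Γ     : mem Γ τ ≡ true
      ∣τ∣≡1+k : ∣ τ ∣ ≡ suc k
      ∣σ∩τ∣≡k : ∣ σ ∩ τ ∣ ≡ k
      σ∪τ∉Γ   : mem Γ (σ ∪ τ) ≡ false

  neighbour : ∀ {k σ τ} → faceᵇ Γ (suc k) τ ∧ adjᵇ Γ k σ τ ≡ true → Neighbour k σ τ
  neighbour {k} {σ} {τ} face∧adj = record
    { τ∈Γ     = proj₁ (simplex face)
    ; ∣τ∣≡1+k = proj₂ (simplex face)
    ; ∣σ∩τ∣≡k = ≡ᵇ-true⇒≡ (BoolP.∧-conicalˡ _ (not (mem Γ (σ ∪ τ))) size∧new)
    ; σ∪τ∉Γ   = BoolP.not-injective (BoolP.∧-conicalʳ (∣ σ ∩ τ ∣ ≡ᵇ k) _ size∧new)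
    }
    where
    face : faceᵇ Γ (suc k) τ ≡ true
    face = BoolP.∧-conicalˡ _ (adjᵇ Γ k σ τ) face∧adj
    size∧new : (∣ σ ∩ τ ∣ ≡ᵇ k) ∧ not (mem Γ (σ ∪ τ)) ≡ true
    size∧new = BoolP.∧-conicalʳ (not (does (σ ≟ˢ τ))) _ (BoolP.∧-conicalʳ (faceᵇ Γ (suc k) τ) _ face∧adj)

  ∣σ∪τ∣≡2+k : ∀ {k σ τ} → IsSimplex Γ k σ → Neighbour k σ τ → ∣ σ ∪ τ ∣ ≡ suc (suc k)
  ∣σ∪τ∣≡2+k {k} {σ} {τ} (_ , ∣σ∣≡1+k) nb = ℕP.+-cancelʳ-≡ k _ _ (begin
    ∣ σ ∪ τ ∣ ℕ.+ k              ≡⟨ cong (∣ σ ∪ τ ∣ ℕ.+_) ∣σ∩τ∣≡k ⟨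
    ∣ σ ∪ τ ∣ ℕ.+ ∣ σ ∩ τ ∣      ≡⟨ ∣∪∣+∣∩∣ σ τ ⟩
    ∣ σ ∣ ℕ.+ ∣ τ ∣              ≡⟨ cong₂ ℕ._+_ ∣σ∣≡1+k ∣τ∣≡1+k ⟩
    suc k ℕ.+ suc k             ≡⟨ ℕP.+-suc (suc k) k ⟩
    suc (suc k) ℕ.+ k           ∎)
    where
    open ≡-Reasoning
    open Neighbour nb

  1+k≤n : ∀ {k σ} → IsSimplex Γ k σ → suc k ≤ n
  1+k≤n {σ = σ} (_ , ∣σ∣≡1+k) = subst (_≤ n) ∣σ∣≡1+k (∣p∣≤n σ)

  neighbour-exchange : ∀ {k σ τ} → IsSimplex Γ k σ → Neighbour k σ τ → exchangeᵇ σ τ ≡ true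
  neighbour-exchange (_ , ∣σ∣≡1+k) nb = cong₂ _∧_
    (≡⇒≡ᵇ-true (trans ∣τ∣≡1+k (sym ∣σ∣≡1+k))) (≡⇒≡ᵇ-true (trans (cong suc ∣σ∩τ∣≡k) (sym ∣σ∣≡1+k)))
    where open Neighbour nb

  deg-bound : ∀ {k σ} → IsSimplex Γ k σ → deg Γ k σ ≤ (n ∸ k ∸ 1) * suc k
  deg-bound {k} {σ} σ-simplex@(_ , ∣σ∣≡1+k) = ℤP.drop‿+≤+ (begin
    + deg Γ k σ
      ≡⟨ deg-as-∑ k σ ⟩
    ∑ (λ τ → 𝟙 (faceᵇ Γ (suc k) τ ∧ adjᵇ Γ k σ τ))
      ≤⟨ ∑-mono-≤ {n} (λ τ → 𝟙-mono (neighbour-exchange σ-simplex ∘ neighbour)) ⟩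
    ∑ (λ τ → 𝟙 (exchangeᵇ σ τ))
      ≡⟨ ∑-exchange σ ⟩
    + ∣ σ ∣ ℤ.* (+ n ℤ.- + ∣ σ ∣)
      ≡⟨ cong (λ s → + s ℤ.* (+ n ℤ.- + s)) ∣σ∣≡1+k ⟩
    + suc k ℤ.* (+ n ℤ.- + suc k)
      ≡⟨ cong (+ suc k ℤ.*_) (m-n≡m∸n (1+k≤n σ-simplex)) ⟩
    + suc k ℤ.* + (n ∸ suc k)
      ≡⟨ ℤP.pos-* (suc k) (n ∸ suc k) ⟨
    + (suc k * (n ∸ suc k))
      ≡⟨ cong +_ (trans (ℕP.*-comm (suc k) _) (cong (_* suc k) (∸-suc n k))) ⟩
    + ((n ∸ k ∸ 1) * suc k)
      ∎)
    where open ℤP.≤-Reasoning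

  σ-facet-of-∪ : ∀ {k σ τ} → IsSimplex Γ k σ → Neighbour k σ τ → facetᵇ σ (σ ∪ τ) ≡ true
  σ-facet-of-∪ {k} {σ} {τ} σ-simplex@(_ , ∣σ∣≡1+k) nb = trans (facetᵇ-as-⊆ σ (σ ∪ τ)) (cong₂ _∧_
    (dec-true (σ ⊆? σ ∪ τ) (p⊆p∪q τ))
    (≡⇒≡ᵇ-true (trans (∣σ∪τ∣≡2+k σ-simplex nb) (cong suc (sym ∣σ∣≡1+k)))))

  -- Otherwise σ ∪ τ = σ ∪ τ′ = τ ∪ τ′ would be a clique, hence a simplex of Γ.
  neighbours-∪-injective : (G : Graph n) → IsCliqueComplexOf Γ G → ∀ {k σ τ τ′} → IsSimplex Γ k σ →
    Neighbour k σ τ → Neighbour k σ τ′ → σ ∪ τ ≡ σ ∪ τ′ → τ ≡ τ′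
  neighbours-∪-injective G clique-complex {k} {σ} {τ} {τ′} σ-simplex nb nb′ σ∪τ≡σ∪τ′ with τ ≟ˢ τ′
  ... | yes τ≡τ′ = τ≡τ′
  ... | no  τ≢τ′ = ⊥-elim (true≢false (trans (sym σ∪τ∈Γ) (σ∪τ∉Γ nb)))
    where
    open Neighbour
    τ∪τ′≡σ∪τ : τ ∪ τ′ ≡ σ ∪ τ
    τ∪τ′≡σ∪τ = ⊆-∣∣-antisym
      (λ x∈ → [ q⊆p∪q σ τ , subst (_ ∈_) (sym σ∪τ≡σ∪τ′) ∘ q⊆p∪q σ τ′ ]′ (x∈p∪q⁻ τ τ′ x∈))
      (ℕP.≤-trans (ℕP.≤-reflexive (trans (∣σ∪τ∣≡2+k σ-simplex nb) (cong suc (sym (∣τ∣≡1+k nb)))))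
                  (∣∪∣-> τ≢τ′ (trans (∣τ∣≡1+k nb) (sym (∣τ∣≡1+k nb′)))))
    σ∪τ∈Γ : mem Γ (σ ∪ τ) ≡ true
    σ∪τ∈Γ = proj₂ (clique-complex (σ ∪ τ)) (∪-clique G
      (proj₁ (clique-complex σ) (proj₁ σ-simplex))
      (proj₁ (clique-complex τ) (τ∈Γ nb))
      (proj₁ (clique-complex τ′) (τ∈Γ nb′))
      σ∪τ≡σ∪τ′ (sym τ∪τ′≡σ∪τ))

  deg-bound-clique : (G : Graph n) → IsCliqueComplexOf Γ G →
    ∀ {k σ} → IsSimplex Γ k σ → deg Γ k σ ≤ n ∸ k ∸ 1
  deg-bound-clique G clique-complex {k} {σ} σ-simplex@(_ , ∣σ∣≡1+k) = ℤP.drop‿+≤+ (begin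
    + deg Γ k σ
      ≡⟨ deg-as-∑ k σ ⟩
    ∑ (λ τ → 𝟙 (faceᵇ Γ (suc k) τ ∧ adjᵇ Γ k σ τ))
      ≤⟨ ∑-𝟙-injection _ (facetᵇ σ) (σ ∪_) (λ τ → σ-facet-of-∪ σ-simplex ∘ neighbour) ∪-injective ⟩
    ∑ (λ μ → 𝟙 (facetᵇ σ μ))
      ≡⟨ ∑-cofacets σ ⟩
    + n ℤ.- + ∣ σ ∣
      ≡⟨ cong (λ s → + n ℤ.- + s) ∣σ∣≡1+k ⟩
    + n ℤ.- + suc k
      ≡⟨ m-n≡m∸n (1+k≤n σ-simplex) ⟩
    + (n ∸ suc k)
      ≡⟨ cong +_ (∸-suc n k) ⟩
    + (n ∸ k ∸ 1)
      ∎)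
    where
    open ℤP.≤-Reasoning
    ∪-injective : ∀ τ τ′ → faceᵇ Γ (suc k) τ ∧ adjᵇ Γ k σ τ ≡ true →
      faceᵇ Γ (suc k) τ′ ∧ adjᵇ Γ k σ τ′ ≡ true → σ ∪ τ ≡ σ ∪ τ′ → τ ≡ τ′
    ∪-injective τ τ′ adj adj′ =
      neighbours-∪-injective G clique-complex σ-simplex (neighbour adj) (neighbour adj′)

toℚᵘ-/ : ∀ z n .{{_ : NonZero n}} → ℚ.toℚᵘ (z ℚ./ n) ℚᵘ.≃ mkℚᵘ z (ℕ.pred n)
toℚᵘ-/ z (suc m) = ℚP.toℚᵘ-fromℚᵘ (mkℚᵘ z m)

/-+ : ∀ a b n .{{_ : NonZero n}} → a ℚ./ n ℚ.+ b ℚ./ n ≡ (a ℤ.+ b) ℚ./ n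
/-+ a b n = ℚP.toℚᵘ-injective (begin
  ℚ.toℚᵘ (a ℚ./ n ℚ.+ b ℚ./ n)               ≈⟨ ℚP.toℚᵘ-homo-+ (a ℚ./ n) (b ℚ./ n) ⟩
  ℚ.toℚᵘ (a ℚ./ n) ℚᵘ.+ ℚ.toℚᵘ (b ℚ./ n)     ≈⟨ ℚᵘP.+-cong (toℚᵘ-/ a n) (toℚᵘ-/ b n) ⟩
  mkℚᵘ a d ℚᵘ.+ mkℚᵘ b d                     ≈⟨ *≡* (common-denominator a b (+ suc d)) ⟩
  mkℚᵘ (a ℤ.+ b) d                           ≈⟨ toℚᵘ-/ (a ℤ.+ b) n ⟨
  ℚ.toℚᵘ ((a ℤ.+ b) ℚ./ n)                   ∎)
  where
  open ℚᵘP.≃-Reasoning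
  d : ℕ
  d = ℕ.pred n
  common-denominator : ∀ a b d → (a ℤ.* d ℤ.+ b ℤ.* d) ℤ.* d ≡ (a ℤ.+ b) ℤ.* (d ℤ.* d)
  common-denominator = solve-∀

-/ : ∀ z n .{{_ : NonZero n}} → ℚ.- (z ℚ./ n) ≡ (ℤ.- z) ℚ./ n
-/ z n = ℚP.toℚᵘ-injective (begin
  ℚ.toℚᵘ (ℚ.- (z ℚ./ n))        ≈⟨ ℚP.toℚᵘ-homo‿- (z ℚ./ n) ⟩
  ℚᵘ.- ℚ.toℚᵘ (z ℚ./ n)         ≈⟨ ℚᵘP.-‿cong (toℚᵘ-/ z n) ⟩
  mkℚᵘ (ℤ.- z) (ℕ.pred n)       ≈⟨ toℚᵘ-/ (ℤ.- z) n ⟨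
  ℚ.toℚᵘ ((ℤ.- z) ℚ./ n)        ∎)
  where open ℚᵘP.≃-Reasoning

n/n≡1 : ∀ n .{{_ : NonZero n}} → + n ℚ./ n ≡ 1ℚ
n/n≡1 (suc m) = ℚP.toℚᵘ-injective (ℚᵘP.≃-trans (toℚᵘ-/ (+ suc m) (suc m)) (*≡* (swap (+ suc m))))
  where
  swap : ∀ d → d ℤ.* 1ℤ ≡ 1ℤ ℤ.* d
  swap = solve-∀

1+/ : ∀ z n .{{_ : NonZero n}} → 1ℚ ℚ.+ z ℚ./ n ≡ (+ n ℤ.+ z) ℚ./ n
1+/ z n = trans (cong (ℚ._+ z ℚ./ n) (sym (n/n≡1 n))) (/-+ (+ n) z n)

∣/∣ : ∀ z n .{{_ : NonZero n}} → ℚ.∣ z ℚ./ n ∣ ≡ + ℤ.∣ z ∣ ℚ./ n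
∣/∣ (+ x)    n = ℚP.0≤p⇒∣p∣≡p (ℚP.nonNegative⁻¹ _ {{ℚP.normalize-nonNeg x n}})
∣/∣ -[1+ x ] n = trans (ℚP.∣-p∣≡∣p∣ (ℚ.normalize (suc x) n))
  (ℚP.0≤p⇒∣p∣≡p (ℚP.nonNegative⁻¹ _ {{ℚP.normalize-nonNeg (suc x) n}}))

sumℚ-/ : ∀ (f : A → ℤ) n .{{_ : NonZero n}} xs → sumℚ (map (λ x → f x ℚ./ n) xs) ≡ sumℤ (map f xs) ℚ./ n
sumℚ-/ f n []       = sym (ℚP.0/n≡0 n)
sumℚ-/ f n (x ∷ xs) = trans (cong (f x ℚ./ n ℚ.+_) (sumℚ-/ f n xs)) (/-+ (f x) _ n)

/-as-* : ∀ z n .{{_ : NonZero n}} → z ℚ./ n ≡ fromℤ z ℚ.* (1ℤ ℚ./ n)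
/-as-* z n = ℚP.toℚᵘ-injective (begin
  ℚ.toℚᵘ (z ℚ./ n)                                ≈⟨ toℚᵘ-/ z n ⟩
  mkℚᵘ z (ℕ.pred n)                               ≈⟨ *≡* (reassociate z (+ suc (ℕ.pred n))) ⟩
  mkℚᵘ z 0 ℚᵘ.* mkℚᵘ 1ℤ (ℕ.pred n)                ≈⟨ ℚᵘP.*-cong (toℚᵘ-/ z 1) (toℚᵘ-/ 1ℤ n) ⟨
  ℚ.toℚᵘ (fromℤ z) ℚᵘ.* ℚ.toℚᵘ (1ℤ ℚ./ n)         ≈⟨ ℚP.toℚᵘ-homo-* (fromℤ z) (1ℤ ℚ./ n) ⟨
  ℚ.toℚᵘ (fromℤ z ℚ.* (1ℤ ℚ./ n))                 ∎)
  where
  open ℚᵘP.≃-Reasoning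
  reassociate : ∀ z d → z ℤ.* (1ℤ ℤ.* d) ≡ (z ℤ.* 1ℤ) ℤ.* d
  reassociate = solve-∀

÷₀-≢0 : ∀ p q (q≢0 : q ≢ 0ℚ) → p ÷₀ q ≡ (p ÷ q) {{≢-nonZero q≢0}}
÷₀-≢0 p q q≢0 with q ℚP.≟ 0ℚ
... | yes q≡0 = ⊥-elim (q≢0 q≡0)
... | no  _   = refl

0÷₀ : ∀ q → 0ℚ ÷₀ q ≡ 0ℚ
0÷₀ q with q ℚP.≟ 0ℚ
... | yes _   = refl
... | no  q≢0 = ℚP.*-zeroˡ ((ℚ.1/ q) {{≢-nonZero q≢0}})

÷₀-*-cancelʳ : ∀ p q r → q ℚ.* r ≢ 0ℚ → (p ℚ.* r) ÷₀ (q ℚ.* r) ≡ p ÷₀ q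
÷₀-*-cancelʳ p q r qr≢0 = begin
  (p ℚ.* r) ÷₀ (q ℚ.* r)               ≡⟨ ÷₀-≢0 _ _ qr≢0 ⟩
  p ℚ.* r ℚ.* ℚ.1/ (q ℚ.* r)           ≡⟨ cong (ℚ._* ℚ.1/ (q ℚ.* r)) multiply-back ⟨
  p/q ℚ.* (q ℚ.* r) ℚ.* ℚ.1/ (q ℚ.* r) ≡⟨ ℚP.*-assoc p/q _ _ ⟩
  p/q ℚ.* (q ℚ.* r ℚ.* ℚ.1/ (q ℚ.* r)) ≡⟨ cong (p/q ℚ.*_) (ℚP.*-inverseʳ (q ℚ.* r)) ⟩
  p/q ℚ.* 1ℚ                           ≡⟨ ℚP.*-identityʳ p/q ⟩
  p/q                                  ≡⟨ ÷₀-≢0 p q q≢0 ⟨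
  p ÷₀ q                               ∎
  where
  open ≡-Reasoning
  q≢0 : q ≢ 0ℚ
  q≢0 q≡0 = qr≢0 (trans (cong (ℚ._* r) q≡0) (ℚP.*-zeroˡ r))
  instance
    q-nonZero : ℚ.NonZero q
    q-nonZero = ≢-nonZero q≢0
    qr-nonZero : ℚ.NonZero (q ℚ.* r)
    qr-nonZero = ≢-nonZero qr≢0
  p/q : ℚ.ℚ
  p/q = p ℚ.* ℚ.1/ q
  multiply-back : p/q ℚ.* (q ℚ.* r) ≡ p ℚ.* r
  multiply-back = begin
    p ℚ.* ℚ.1/ q ℚ.* (q ℚ.* r)   ≡⟨ ℚP.*-assoc p _ _ ⟩
    p ℚ.* (ℚ.1/ q ℚ.* (q ℚ.* r)) ≡⟨ cong (p ℚ.*_) (ℚP.*-assoc (ℚ.1/ q) q r) ⟨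
    p ℚ.* (ℚ.1/ q ℚ.* q ℚ.* r)   ≡⟨ cong (λ t → p ℚ.* (t ℚ.* r)) (ℚP.*-inverseˡ q) ⟩
    p ℚ.* (1ℚ ℚ.* r)             ≡⟨ cong (p ℚ.*_) (ℚP.*-identityˡ r) ⟩
    p ℚ.* r                      ∎

-- The columns of H

nH : SimplicialComplex n → ℕ → Subset n → Subset n → ℤ
nH {n} Γ k τ σ = + n ℤ.* δℤ τ σ ℤ.- Δ Γ k τ σ

H-as-/ : .{{_ : NonZero n}} (Γ : SimplicialComplex n) → ∀ k τ σ → H Γ k τ σ ≡ nH Γ k τ σ ℚ./ n
H-as-/ {n} Γ k τ σ =
  trans (cong₂ ℚ._+_ δ-as-/ (-/ (Δ Γ k τ σ) n)) (/-+ (+ n ℤ.* δℤ τ σ) (ℤ.- Δ Γ k τ σ) n)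
  where
  δ-as-/ : δ τ σ ≡ (+ n ℤ.* δℤ τ σ) ℚ./ n
  δ-as-/ with does (τ ≟ˢ σ)
  ... | true  = sym (trans (cong (λ z → z ℚ./ n) (ℤP.*-identityʳ (+ n))) (n/n≡1 n))
  ... | false = sym (trans (cong (λ z → z ℚ./ n) (ℤP.*-zeroʳ (+ n))) (ℚP.0/n≡0 n))

module Column .{{_ : NonZero n}} (Γ : SimplicialComplex n) {k σ} (σ-simplex : IsSimplex Γ k σ) where

  -- n ⟨σ|H|σ⟩ and n ‖H|σ⟩‖₁
  diag total : ℤ
  diag  = + n ℤ.- + dup Γ k σ ℤ.- + k ℤ.- 1ℤ
  total = + n ℤ.+ + deg Γ k σ ℤ.- + dup Γ k σ ℤ.- + k ℤ.- 1ℤ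

  nH-diag : nH Γ k σ σ ≡ diag
  nH-diag = trans (cong₂ (λ d D → + n ℤ.* d ℤ.- D) (δℤ-refl σ) (Δ-diag Γ σ-simplex))
                  (rearrange (+ n) (+ dup Γ k σ) (+ k))
    where
    rearrange : ∀ n d k → n ℤ.* 1ℤ ℤ.- ((1ℤ ℤ.+ k) ℤ.+ d) ≡ n ℤ.- d ℤ.- k ℤ.- 1ℤ
    rearrange = solve-∀

  diag≥0 : 0ℤ ℤ.≤ diag
  diag≥0 = subst (0ℤ ℤ.≤_) (rearrange (+ n) (+ dup Γ k σ) (+ k)) (ℤP.i≤j⇒0≤j-i (dup-bound Γ σ-simplex))
    where
    rearrange : ∀ n d k → n ℤ.- (1ℤ ℤ.+ k) ℤ.- d ≡ n ℤ.- d ℤ.- k ℤ.- 1ℤ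
    rearrange = solve-∀

  ∣nH∣-diag : + ℤ.∣ nH Γ k σ σ ∣ ≡ diag
  ∣nH∣-diag = trans (cong (+_ ∘ ℤ.∣_∣) nH-diag) (ℤP.0≤i⇒+∣i∣≡i diag≥0)

  ∣nH∣-off : ∀ {τ} → IsSimplex Γ k τ → τ ≢ σ → + ℤ.∣ nH Γ k τ σ ∣ ≡ 𝟙 (adjᵇ Γ k σ τ)
  ∣nH∣-off {τ} τ-simplex τ≢σ = begin
    + ℤ.∣ + n ℤ.* δℤ τ σ ℤ.- Δ Γ k τ σ ∣  ≡⟨ cong (λ d → + ℤ.∣ + n ℤ.* d ℤ.- Δ Γ k τ σ ∣) (δℤ-≢ τ≢σ) ⟩
    + ℤ.∣ + n ℤ.* 0ℤ ℤ.- Δ Γ k τ σ ∣      ≡⟨ cong (+_ ∘ ℤ.∣_∣) (annihilate (+ n) (Δ Γ k τ σ)) ⟩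
    + ℤ.∣ ℤ.- Δ Γ k τ σ ∣                 ≡⟨ cong +_ (ℤP.∣-i∣≡∣i∣ (Δ Γ k τ σ)) ⟩
    + ℤ.∣ Δ Γ k τ σ ∣                     ≡⟨ ∣Δ∣-off Γ τ-simplex σ-simplex τ≢σ ⟩
    𝟙 (adjᵇ Γ k σ τ)                      ∎
    where open ≡-Reasoning

  ∣nH∣ : ∀ {τ} → IsSimplex Γ k τ → + ℤ.∣ nH Γ k τ σ ∣ ≡ diag ℤ.* δℤ τ σ ℤ.+ 𝟙 (adjᵇ Γ k σ τ)
  ∣nH∣ {τ} τ-simplex = by-cases (τ ≟ˢ σ)
    where
    by-cases : Dec (τ ≡ σ) → + ℤ.∣ nH Γ k τ σ ∣ ≡ diag ℤ.* δℤ τ σ ℤ.+ 𝟙 (adjᵇ Γ k σ τ)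
    by-cases (yes τ≡σ) rewrite τ≡σ = sym (begin
      diag ℤ.* δℤ σ σ ℤ.+ 𝟙 (adjᵇ Γ k σ σ)
        ≡⟨ cong₂ (λ d a → diag ℤ.* d ℤ.+ 𝟙 a) (δℤ-refl σ) (adjᵇ-irrefl Γ σ) ⟩
      diag ℤ.* 1ℤ ℤ.+ 0ℤ
        ≡⟨ trans (ℤP.+-identityʳ _) (ℤP.*-identityʳ diag) ⟩
      diag
        ≡⟨ ∣nH∣-diag ⟨
      + ℤ.∣ nH Γ k σ σ ∣
        ∎)
      where open ≡-Reasoning
    by-cases (no τ≢σ) = begin
      + ℤ.∣ nH Γ k τ σ ∣
        ≡⟨ ∣nH∣-off τ-simplex τ≢σ ⟩
      𝟙 (adjᵇ Γ k σ τ)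
        ≡⟨ ℤP.+-identityˡ _ ⟨
      0ℤ ℤ.+ 𝟙 (adjᵇ Γ k σ τ)
        ≡⟨ cong (ℤ._+ 𝟙 (adjᵇ Γ k σ τ)) (trans (cong (diag ℤ.*_) (δℤ-≢ τ≢σ)) (ℤP.*-zeroʳ diag)) ⟨
      diag ℤ.* δℤ τ σ ℤ.+ 𝟙 (adjᵇ Γ k σ τ)
        ∎
      where open ≡-Reasoning

  column-sum : sumℤ (map (λ τ → + ℤ.∣ nH Γ k τ σ ∣) (S Γ k)) ≡ total
  column-sum = begin
    sumℤ (map (λ τ → + ℤ.∣ nH Γ k τ σ ∣) (S Γ k))
      ≡⟨ sum-facesOfSize-cong Γ (suc k) (λ τ → ∣nH∣ ∘ simplex Γ) ⟩
    sumℤ (map (λ τ → diag ℤ.* δℤ τ σ ℤ.+ 𝟙 (adjᵇ Γ k σ τ)) (S Γ k))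
      ≡⟨ sum-map-+ (λ τ → diag ℤ.* δℤ τ σ) (λ τ → 𝟙 (adjᵇ Γ k σ τ)) (S Γ k) ⟩
    sumℤ (map (λ τ → diag ℤ.* δℤ τ σ) (S Γ k)) ℤ.+ sumℤ (map (λ τ → 𝟙 (adjᵇ Γ k σ τ)) (S Γ k))
      ≡⟨ cong₂ ℤ._+_ (sum-map-*ˡ diag (λ τ → δℤ τ σ) (S Γ k)) (sym (deg-as-sum Γ k σ)) ⟩
    diag ℤ.* sumℤ (map (λ τ → δℤ τ σ) (S Γ k)) ℤ.+ + deg Γ k σ
      ≡⟨ cong (λ c → diag ℤ.* c ℤ.+ + deg Γ k σ) (sum-δℤ-simplices Γ σ-simplex) ⟩
    diag ℤ.* 1ℤ ℤ.+ + deg Γ k σ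
      ≡⟨ rearrange (+ n) (+ deg Γ k σ) (+ dup Γ k σ) (+ k) ⟩
    total
      ∎
    where
    open ≡-Reasoning
    rearrange : ∀ n g d k → (n ℤ.- d ℤ.- k ℤ.- 1ℤ) ℤ.* 1ℤ ℤ.+ g ≡ n ℤ.+ g ℤ.- d ℤ.- k ℤ.- 1ℤ
    rearrange = solve-∀

  ∣H∣-as-/ : ∀ τ → ℚ.∣ H Γ k τ σ ∣ ≡ + ℤ.∣ nH Γ k τ σ ∣ ℚ./ n
  ∣H∣-as-/ τ = trans (cong ℚ.∣_∣ (H-as-/ Γ k τ σ)) (∣/∣ (nH Γ k τ σ) n)

  norm1-as-/ : norm1 Γ k σ ≡ total ℚ./ n
  norm1-as-/ = begin
    sumℚ (map (λ τ → ℚ.∣ H Γ k τ σ ∣) (S Γ k))            ≡⟨ cong sumℚ (ListP.map-cong ∣H∣-as-/ (S Γ k)) ⟩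
    sumℚ (map (λ τ → + ℤ.∣ nH Γ k τ σ ∣ ℚ./ n) (S Γ k))   ≡⟨ sumℚ-/ (λ τ → + ℤ.∣ nH Γ k τ σ ∣) n (S Γ k) ⟩
    sumℤ (map (λ τ → + ℤ.∣ nH Γ k τ σ ∣) (S Γ k)) ℚ./ n   ≡⟨ cong (λ z → z ℚ./ n) column-sum ⟩
    total ℚ./ n                                           ∎
    where open ≡-Reasoning

  norm1-formula : norm1 Γ k σ ≡ 1ℚ ℚ.+ ((+ deg Γ k σ ℤ.- + dup Γ k σ ℤ.- + k ℤ.- 1ℤ) ℚ./ n)
  norm1-formula = begin
    norm1 Γ k σ                 ≡⟨ norm1-as-/ ⟩
    total ℚ./ n                 ≡⟨ cong (λ z → z ℚ./ n) shift ⟩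
    (+ n ℤ.+ excess) ℚ./ n      ≡⟨ 1+/ excess n ⟨
    1ℚ ℚ.+ excess ℚ./ n         ∎
    where
    open ≡-Reasoning
    excess : ℤ
    excess = + deg Γ k σ ℤ.- + dup Γ k σ ℤ.- + k ℤ.- 1ℤ
    rearrange : ∀ n g d k → n ℤ.+ g ℤ.- d ℤ.- k ℤ.- 1ℤ ≡ n ℤ.+ (g ℤ.- d ℤ.- k ℤ.- 1ℤ)
    rearrange = solve-∀
    shift : total ≡ + n ℤ.+ excess
    shift = rearrange (+ n) (+ deg Γ k σ) (+ dup Γ k σ) (+ k)

  P-as-÷₀ : norm1 Γ k σ ≢ 0ℚ → ∀ τ → P Γ k σ τ ≡ fromℤ (+ ℤ.∣ nH Γ k τ σ ∣) ÷₀ fromℤ total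
  P-as-÷₀ norm1≢0 τ = begin
    ℚ.∣ H Γ k τ σ ∣ ÷₀ norm1 Γ k σ       ≡⟨ cong₂ _÷₀_ (∣H∣-as-/ τ) norm1-as-/ ⟩
    (a ℚ./ n) ÷₀ (total ℚ./ n)            ≡⟨ cong₂ _÷₀_ (/-as-* a n) (/-as-* total n) ⟩
    (fromℤ a ℚ.* c) ÷₀ (fromℤ total ℚ.* c) ≡⟨ ÷₀-*-cancelʳ (fromℤ a) (fromℤ total) c total*c≢0 ⟩
    fromℤ a ÷₀ fromℤ total                ∎
    where
    open ≡-Reasoning
    a : ℤ
    a = + ℤ.∣ nH Γ k τ σ ∣
    c : ℚ.ℚ
    c = 1ℤ ℚ./ n
    total*c≢0 : fromℤ total ℚ.* c ≢ 0ℚ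
    total*c≢0 = norm1≢0 ∘ trans (trans norm1-as-/ (/-as-* total n))

  transition-probabilities : norm1 Γ k σ ≢ 0ℚ → ∀ {τ} → IsSimplex Γ k τ →
    (Adjacent Γ k σ τ → P Γ k σ τ ≡ 1ℚ ÷₀ fromℤ total)
    × (σ ≡ τ → P Γ k σ τ ≡ fromℤ diag ÷₀ fromℤ total)
    × (¬ Adjacent Γ k σ τ → σ ≢ τ → P Γ k σ τ ≡ 0ℚ)
  transition-probabilities norm1≢0 {τ} τ-simplex = adjacent , same , other
    where
    numerator : ∀ {a} → + ℤ.∣ nH Γ k τ σ ∣ ≡ a → P Γ k σ τ ≡ fromℤ a ÷₀ fromℤ total
    numerator eq = trans (P-as-÷₀ norm1≢0 τ) (cong (λ a → fromℤ a ÷₀ fromℤ total) eq)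
    adjacent : Adjacent Γ k σ τ → P Γ k σ τ ≡ 1ℚ ÷₀ fromℤ total
    adjacent adj = numerator (trans (∣nH∣-off τ-simplex τ≢σ) (cong 𝟙 adj))
      where
      τ≢σ : τ ≢ σ
      τ≢σ refl = true≢false (trans (sym adj) (adjᵇ-irrefl Γ σ))
    same : σ ≡ τ → P Γ k σ τ ≡ fromℤ diag ÷₀ fromℤ total
    same refl = numerator ∣nH∣-diag
    other : ¬ Adjacent Γ k σ τ → σ ≢ τ → P Γ k σ τ ≡ 0ℚ
    other ¬adj σ≢τ =
      trans (numerator (trans (∣nH∣-off τ-simplex (σ≢τ ∘ sym)) (cong 𝟙 (BoolP.¬-not ¬adj))))
            (0÷₀ (fromℤ total))

theorem4 : ∀ {n : ℕ} .{{_ : NonZero n}} (Γ : SimplicialComplex n) (k : ℕ) → 1 ≤ k →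
  -- (a)
  (∀ σ → IsSimplex Γ k σ →
    norm1 Γ k σ ≡ 1ℚ ℚ.+ ((+ deg Γ k σ ℤ.- + dup Γ k σ ℤ.- + k ℤ.- ℤ.1ℤ) ℚ./ n))
  ×
  -- (b)
  (∀ σ τ → IsSimplex Γ k σ → IsSimplex Γ k τ → norm1 Γ k σ ≢ 0ℚ →
    (Adjacent Γ k σ τ →
       P Γ k σ τ ≡ 1ℚ ÷₀ fromℤ (+ n ℤ.+ + deg Γ k σ ℤ.- + dup Γ k σ ℤ.- + k ℤ.- ℤ.1ℤ))
    × (σ ≡ τ →
       P Γ k σ τ ≡ fromℤ (+ n ℤ.- + dup Γ k σ ℤ.- + k ℤ.- ℤ.1ℤ)
                   ÷₀ fromℤ (+ n ℤ.+ + deg Γ k σ ℤ.- + dup Γ k σ ℤ.- + k ℤ.- ℤ.1ℤ))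
    × (¬ Adjacent Γ k σ τ → σ ≢ τ → P Γ k σ τ ≡ 0ℚ))
  ×
  -- (c)
  (∀ σ → IsSimplex Γ k σ → deg Γ k σ ≤ (n ∸ k ∸ 1) * (suc k))
  ×
  (∀ (G : Graph n) → IsCliqueComplexOf Γ G →
    ∀ σ → IsSimplex Γ k σ → deg Γ k σ ≤ n ∸ k ∸ 1)
theorem4 Γ k _ =
  (λ σ σ-simplex → Column.norm1-formula Γ σ-simplex) ,
  (λ σ τ σ-simplex τ-simplex norm1≢0 → Column.transition-probabilities Γ σ-simplex norm1≢0 τ-simplex) ,
  (λ σ σ-simplex → deg-bound Γ σ-simplex) ,
  (λ G clique-complex σ σ-simplex → deg-bound-clique Γ G clique-complex σ-simplex)
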